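{- Let $k\ge 2$ be an integer, let $\gamma,d,\varepsilon$ be real numbers, and let $\mathcal{G}$ be a graph on $\ell$ vertices such that for all nonadjacent $x,y\in V(\mathcal{G})$, \[ d(x)+d(y)\ge 2\left(1-\frac{1}{k-1}+\gamma-d-2\varepsilon\right)\ell . \] Let $\Phi=\{\Phi_k,\ldots,\Phi_1\}$ be a maximal $k$-clique-cover of $\mathcal{G}$, let $\varphi_i=|\Phi_i|/\ell$, and let $i_0=\min\{i\in[1,k]:|\Phi_i|\ge k\}$. Assume $i_0<k$ and $\varphi_i=0$ for all $i<i_0$, and define \[ s=\varphi_k-\sum_{j=2}^{k-i_0}(j-1)\varphi_{k-j}-(k-1)\gamma . \] Let $i\in[1,k-i_0]$. For a clique $K\in\Phi_{k-i}$, let $\Lambda(K)$ be the set of cliques $K^k\in\Phi_k$ such that $K$ is well-connected to $K^k$. Then, with at most one exception, every clique $K\in\Phi_{k-i}$ that is not over-connected to any clique of $\Phi_k$ satisfies \[ \frac{|\Lambda(K)|}{\ell}\ge (k-1)\gamma+\frac{i-1}{k-1}s+\sum_{2\le j\le i}(j-1)\varphi_{k-j}+(i-1)\sum_{j=i+1}^{k-i_0}\varphi_{k-j}-(k-i)(d+2\varepsilon). \] (Equivalently, $\lambda_i$, the minimum of $|\Lambda(K)|/\ell$ over all such cliques $K$ with at most one exception, is at least the right-hand side.)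
   Context: A $k$-clique-cover $\Phi=\{\Phi_k,\Phi_{k-1},\ldots,\Phi_1\}$ of $\mathcal{G}$ is a collection of pairwise vertex-disjoint cliques of $\mathcal{G}$ whose vertex sets cover $V(\mathcal{G})$, where $\Phi_i$ is the set of cliques of order $i$ ($i\in[1,k]$). It is maximal if $(|\Phi_k|,\ldots,|\Phi_1|)$ is lexicographically maximal among all $k$-clique-covers. For vertex sets $A,B$, $e(A,B)=\sum_{v\in A}d(v,B)$. For cliques $K^a$ of order $a$ and $K^b$ of order $b$ with $a\le b$: $K^a$ is well-connected to $K^b$ if every vertex of $K^a$ has exactly $b-1$ neighbors in $K^b$; $K^a$ is over-connected to $K^b$ if $e(K^a,K^b)\ge a(b-1)$ but $K^a$ is not well-connected to $K^b$; $K^a$ is under-connected to $K^b$ if $e(K^a,K^b)<a(b-1)$. $[p,q]=\{i\in\mathbb{Z}:p\le i\le q\}$.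
   Formalization: The parameters γ, d and ε are rational numbers rather than arbitrary real numbers. -}

module Defs where

open import Data.Bool using (Bool; true; false)
open import Data.Nat as ℕ using (ℕ; zero; suc; _∸_; _≤_; _<_)
open import Data.Fin using (Fin)
open import Data.List using (List; []; _∷_; length; filter; filterᵇ; concat; map; upTo; foldr)
open import Data.List.Relation.Unary.All using (All; all?)
open import Data.List.Relation.Unary.AllPairs using (AllPairs)
open import Data.List.Relation.Unary.Unique.Propositional using (Unique)
open import Data.List.Membership.Propositional using (_∈_)
open import Data.Product using (_×_; Σ; ∃)
open import Relation.Nullary using (¬_)
open import Relation.Binary.PropositionalEquality using (_≡_; _≢_)
open import Data.Integer using (+_)
open import Data.Rational as ℚ using (ℚ; _/_; 0ℚ)

record Graph (n : ℕ) : Set where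
  field
    adj    : Fin n → Fin n → Bool
    sym    : ∀ x y → adj x y ≡ adj y x
    irrefl : ∀ x → adj x x ≡ false
open Graph public

module _ {n : ℕ} (G : Graph n) where

  degIn : Fin n → List (Fin n) → ℕ
  degIn v B = length (filterᵇ (adj G v) B)

  deg : Fin n → ℕ
  deg v = degIn v (Data.List.allFin n)
    where import Data.List

  e : List (Fin n) → List (Fin n) → ℕ
  e A B = foldr (λ v acc → degIn v B ℕ.+ acc) 0 A

  -- a clique: list of pairwise adjacent (hence distinct) vertices
  IsClique : List (Fin n) → Set
  IsClique K = AllPairs (λ u v → adj G u v ≡ true) K

  IsCliqueCover : ℕ → List (List (Fin n)) → Set
  IsCliqueCover k Φ =
    All (λ K → IsClique K × 1 ≤ length K × length K ≤ k) Φ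
    × Unique (concat Φ)
    × (∀ v → v ∈ concat Φ)

  ofOrder : List (List (Fin n)) → ℕ → List (List (Fin n))
  ofOrder Φ i = filter (λ K → length K ℕ.≟ i) Φ

  cnt : List (List (Fin n)) → ℕ → ℕ
  cnt Φ i = length (ofOrder Φ i)

  -- (|Ψ_k|,...,|Ψ_1|) is lexicographically larger than (|Φ_k|,...,|Φ_1|)
  LexGreater : ℕ → List (List (Fin n)) → List (List (Fin n)) → Set
  LexGreater k Ψ Φ = Σ ℕ λ j → 1 ≤ j × j ≤ k × cnt Φ j < cnt Ψ j
    × (∀ m → j < m → m ≤ k → cnt Ψ m ≡ cnt Φ m)

  IsMaximalCliqueCover : ℕ → List (List (Fin n)) → Set
  IsMaximalCliqueCover k Φ = IsCliqueCover k Φ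
    × (∀ Ψ → IsCliqueCover k Ψ → ¬ LexGreater k Ψ Φ)

  WellConnected : List (Fin n) → List (Fin n) → Set
  WellConnected A B = All (λ v → degIn v B ≡ length B ∸ 1) A

  wellConnected? : ∀ A B → Relation.Nullary.Dec (WellConnected A B)
  wellConnected? A B = all? (λ v → degIn v B ℕ.≟ (length B ∸ 1)) A
    where import Relation.Nullary

  OverConnected : List (Fin n) → List (Fin n) → Set
  OverConnected A B = (length A ℕ.* (length B ∸ 1) ≤ e A B) × ¬ WellConnected A B

  Λ : List (List (Fin n)) → ℕ → List (Fin n) → List (List (Fin n))
  Λ Φ k K = filter (wellConnected? K) (ofOrder Φ k)

-- rational a / b (only used with b ≥ 1; returns 0 for b = 0)
frac : ℕ → ℕ → ℚ
frac a zero    = 0ℚ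
frac a (suc b) = (+ a) / suc b

ℕtoℚ : ℕ → ℚ
ℕtoℚ a = (+ a) / 1

-- Σ_{j=p}^{q} f j  (empty if q < p)
sumRange : ℕ → ℕ → (ℕ → ℚ) → ℚ
sumRange p q f = foldr (λ j acc → f j ℚ.+ acc) 0ℚ (map (p ℕ.+_) (upTo (suc q ∸ p)))

{-# OPTIONS --safe #-}

-- Fix a = k − i and H = 2(1 − 1/(k−1) + γ − d − 2ε)ℓ, and call K ∈ Φ_a an exception if it is not
-- over-connected to any k-clique of Φ but |Λ(K)| < rhs·ℓ. Two exceptions K, K′ cannot coexist:
-- * Maximality of Φ bounds the edges from K to each block T: if a vertex of the smaller of K, T were
--   adjacent to all of the larger one, of order below k, the two would form a clique that could be
--   split off to improve Φ. Hence Σ_{x∈K} d(x) ≤ E + |Λ(K)|, where E sums a(|T|−1), |T|(a−1) or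
--   a(k−1)−1 over the blocks T, according to their orders.
-- * The Ore-type condition gives Σ_{x∈K∪K′} d(x) ≥ aH: by maximality, a set S ⊆ K of vertices of low
--   degree has at most a − |S| common neighbours in K′, and every other vertex of K′ misses a vertex
--   of S, so it has high degree.
-- * Counting the blocks of Φ by their orders gives aH = 2E + 2·rhs·ℓ exactly.
module Submission where

open import Defs hiding (sym)

open import Data.Bool using (true; false; T; T?)
open import Data.Bool.Properties using (T-≡; ¬-not) renaming (_≟_ to _≟ᵇ_)
open import Data.Empty using (⊥; ⊥-elim)
open import Data.Fin.Base as Fin using (Fin)
import Data.Fin.Properties as Fin
import Data.Integer.Base as ℤ
import Data.Integer.Properties as ℤ
open import Data.Integer.Tactic.RingSolver using (solve-∀)
open import Data.List using (List; []; _∷_; _++_; foldr; length; map; filter; filterᵇ; concat; allFin; take; upTo)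
open import Data.List.Membership.Propositional using (_∈_; _∉_; find; lose)
open import Data.List.Membership.Propositional.Properties
  using (∈-upTo⁺; ∈-upTo⁻; ∈-∃++; ∈-concat⁺′; ∈-filter⁺; ∈-filter⁻; ∈-map⁺; ∈-map⁻; ∈-allFin;
         ∈-++⁺ˡ; ∈-++⁺ʳ; ∈-++⁻)
open import Data.List.Properties
  using (length-take; map-++; filter-++; length-++; filter-all; filter-complete; length-filter; length-tabulate)
open import Data.List.Relation.Binary.Permutation.Propositional using (_↭_; prep; ↭-refl; ↭-sym; ↭-trans; ↭⇒↭ₛ)
open import Data.List.Relation.Binary.Permutation.Propositional.Properties using (shift; ∈-resp-↭; filter-↭; ↭-length; map⁺)
open import Data.List.Relation.Unary.All as All using (All; []; _∷_)
import Data.List.Relation.Unary.All.Properties as All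
open import Data.List.Relation.Unary.AllPairs as AllPairs using (AllPairs; []; _∷_)
import Data.List.Relation.Unary.AllPairs.Properties as AllPairs
open import Data.List.Relation.Unary.Any using (here; there; any?)
open import Data.List.Relation.Unary.Unique.Propositional using (Unique)
open import Data.List.Relation.Unary.Unique.Propositional.Properties as Unique using (allFin⁺; upTo⁺)
open import Data.Nat.Base as ℕ using (ℕ; zero; suc; _+_; _*_; _∸_; _≤_; _<_; z≤n; s≤s)
open import Data.Nat.ListAction using (sum)
open import Data.Nat.ListAction.Properties using (sum-++; sum-↭)
open import Data.Nat.Properties using (_≟_; _≤?_)
import Data.Nat.Properties as ℕ
open import Data.Product using (∃; ∃₂; _×_; _,_; proj₁; proj₂)
open import Data.Rational.Base as ℚ using (ℚ; 0ℚ; 1ℚ)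
import Data.Rational.Properties as ℚ
open import Data.Rational.Solver using (module +-*-Solver)
open import Data.Rational.Unnormalised.Base as ℚᵘ using (ℚᵘ; mkℚᵘ; *≡*; *≤*)
import Data.Rational.Unnormalised.Properties as ℚᵘ
open import Data.Sum using (_⊎_; inj₁; inj₂)
open import Function using (_∘_)
open import Function.Bundles using (Equivalence)
open import Level using (Level)
open import Relation.Binary.Bundles using (DecTotalOrder)
open import Relation.Binary.PropositionalEquality
  using (_≡_; _≢_; refl; sym; trans; cong; cong₂; subst; setoid; module ≡-Reasoning)
open import Relation.Nullary using (¬_; ¬?; Dec; yes; no; _×-dec_; contradiction)
open import Relation.Unary using (Pred; Decidable)

open import Algebra.Properties.CommutativeSemigroup ℕ.+-commutativeSemigroup using (interchange)
open import Algebra.Properties.Group ℚ.+-0-group using () renaming (⁻¹-involutive to neg-involutive)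
import Data.List.Extrema (DecTotalOrder.totalOrder ℚ.≤-decTotalOrder) as Extremaℚ

private
  variable
    α β π : Level
    A : Set α
    B : Set β

∑ : (A → ℕ) → List A → ℕ
∑ f xs = sum (map f xs)

𝟙 : {P : Set π} → Dec P → ℕ
𝟙 (yes _) = 1
𝟙 (no _)  = 0

𝟙-yes : ∀ {P : Set π} (d : Dec P) → P → 𝟙 d ≡ 1
𝟙-yes (yes _) _  = refl
𝟙-yes (no ¬p) p  = contradiction p ¬p

𝟙-no : ∀ {P : Set π} (d : Dec P) → ¬ P → 𝟙 d ≡ 0
𝟙-no (yes p) ¬p = contradiction p ¬p
𝟙-no (no _)  _  = refl

𝟙-pos : ∀ {P : Set π} (d : Dec P) → 0 < 𝟙 d → P
𝟙-pos (yes p) _ = p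

∑-++ : ∀ (f : A → ℕ) xs ys → ∑ f (xs ++ ys) ≡ ∑ f xs + ∑ f ys
∑-++ f xs ys = trans (cong sum (map-++ f xs ys)) (sum-++ (map f xs) (map f ys))

∑-cong : ∀ {f g : A → ℕ} xs → (∀ {x} → x ∈ xs → f x ≡ g x) → ∑ f xs ≡ ∑ g xs
∑-cong []       eq = refl
∑-cong (x ∷ xs) eq = cong₂ _+_ (eq (here refl)) (∑-cong xs (eq ∘ there))

∑-mono : ∀ {f g : A → ℕ} xs → (∀ {x} → x ∈ xs → f x ≤ g x) → ∑ f xs ≤ ∑ g xs
∑-mono []       le = z≤n
∑-mono (x ∷ xs) le = ℕ.+-mono-≤ (le (here refl)) (∑-mono xs (le ∘ there))

∑-zero : ∀ {f : A → ℕ} xs → (∀ {x} → x ∈ xs → f x ≡ 0) → ∑ f xs ≡ 0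
∑-zero []       eq = refl
∑-zero (x ∷ xs) eq = cong₂ _+_ (eq (here refl)) (∑-zero xs (eq ∘ there))

∑-+ : ∀ (f g : A → ℕ) xs → ∑ (λ x → f x + g x) xs ≡ ∑ f xs + ∑ g xs
∑-+ f g []       = refl
∑-+ f g (x ∷ xs) = trans (cong (f x + g x +_) (∑-+ f g xs)) (interchange (f x) (g x) (∑ f xs) (∑ g xs))

∑-*ˡ : ∀ c (f : A → ℕ) xs → ∑ (λ x → c * f x) xs ≡ c * ∑ f xs
∑-*ˡ c f []       = sym (ℕ.*-zeroʳ c)
∑-*ˡ c f (x ∷ xs) = trans (cong (c * f x +_) (∑-*ˡ c f xs)) (sym (ℕ.*-distribˡ-+ c (f x) (∑ f xs)))

∑-swap : ∀ (f : A → B → ℕ) xs ys →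
         ∑ (λ x → ∑ (f x) ys) xs ≡ ∑ (λ y → ∑ (λ x → f x y) xs) ys
∑-swap f []       ys = sym (∑-zero ys (λ _ → refl))
∑-swap f (x ∷ xs) ys = trans (cong (∑ (f x) ys +_) (∑-swap f xs ys))
                             (sym (∑-+ (f x) (λ y → ∑ (λ x → f x y) xs) ys))

∑-map : ∀ (f : B → ℕ) (g : A → B) xs → ∑ f (map g xs) ≡ ∑ (f ∘ g) xs
∑-map f g []       = refl
∑-map f g (x ∷ xs) = cong (f (g x) +_) (∑-map f g xs)

∑-const : ∀ c (xs : List A) → ∑ (λ _ → c) xs ≡ length xs * c
∑-const c []       = refl
∑-const c (x ∷ xs) = cong (c +_) (∑-const c xs)

∑-↭ : ∀ (f : A → ℕ) {xs ys} → xs ↭ ys → ∑ f xs ≡ ∑ f ys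
∑-↭ f σ = sum-↭ (map⁺ f σ)

∑-member : ∀ (f : A → ℕ) {x xs} → x ∈ xs → f x ≤ ∑ f xs
∑-member f {xs = y ∷ xs} (here refl) = ℕ.m≤m+n (f y) (∑ f xs)
∑-member f {xs = y ∷ xs} (there x∈) = ℕ.≤-trans (∑-member f x∈) (ℕ.m≤n+m (∑ f xs) (f y))

∑-pos : ∀ (f : A → ℕ) xs → 0 < ∑ f xs → ∃ λ x → x ∈ xs × 0 < f x
∑-pos f (x ∷ xs) pos with f x in fx
... | suc _ = x , here refl , subst (0 <_) (sym fx) (s≤s z≤n)
... | zero with y , y∈ , fy ← ∑-pos f xs pos = y , there y∈ , fy

length-concat : ∀ (xss : List (List A)) → length (concat xss) ≡ ∑ length xss
length-concat []         = refl
length-concat (xs ∷ xss) = trans (length-++ xs) (cong (length xs +_) (length-concat xss))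

module _ {P : Pred A π} (P? : Decidable P) where

  length-filter≡∑ : ∀ xs → length (filter P? xs) ≡ ∑ (𝟙 ∘ P?) xs
  length-filter≡∑ []       = refl
  length-filter≡∑ (x ∷ xs) with P? x
  ... | yes _ = cong suc (length-filter≡∑ xs)
  ... | no  _ = length-filter≡∑ xs

  ∑-filter : ∀ (f : A → ℕ) xs → (∀ {x} → x ∈ xs → ¬ P x → f x ≡ 0) → ∑ f (filter P? xs) ≡ ∑ f xs
  ∑-filter f []       _    = refl
  ∑-filter f (x ∷ xs) vanish with P? x
  ... | yes _  = cong (f x +_) (∑-filter f xs (vanish ∘ there))
  ... | no ¬px = trans (∑-filter f xs (vanish ∘ there)) (cong (_+ ∑ f xs) (sym (vanish (here refl) ¬px)))

∑-filter-𝟙 : ∀ {P : Pred A π} (P? : Decidable P) (f : A → ℕ) xs → ∑ f (filter P? xs) ≡ ∑ (λ x → 𝟙 (P? x) * f x) xs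
∑-filter-𝟙 P? f []       = refl
∑-filter-𝟙 P? f (x ∷ xs) with P? x
... | yes _ = cong₂ _+_ (sym (ℕ.+-identityʳ (f x))) (∑-filter-𝟙 P? f xs)
... | no  _ = ∑-filter-𝟙 P? f xs

∈-take : ∀ {x : A} n xs → x ∈ take n xs → x ∈ xs
∈-take (suc n) (y ∷ xs) (here refl) = here refl
∈-take (suc n) (y ∷ xs) (there x∈)  = there (∈-take n xs x∈)

extract : ∀ {x : A} {xs} → x ∈ xs → ∃ λ R → xs ↭ x ∷ R
extract {x = x} x∈ with as , bs , refl ← ∈-∃++ x∈ = as ++ bs , shift x as bs

unique-++-disjoint : ∀ {x : A} xs {ys} → Unique (xs ++ ys) → x ∈ xs → x ∈ ys → ⊥
unique-++-disjoint (z ∷ xs) (z∉ ∷ _) (here refl)  x∈ys = All.lookup z∉ (∈-++⁺ʳ xs x∈ys) refl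
unique-++-disjoint (z ∷ xs) (_ ∷ u)  (there x∈xs) x∈ys = unique-++-disjoint xs u x∈xs x∈ys

unique-++ʳ : ∀ xs {ys : List A} → Unique (xs ++ ys) → Unique ys
unique-++ʳ []       u       = u
unique-++ʳ (_ ∷ xs) (_ ∷ u) = unique-++ʳ xs u

unique-resp-↭ : ∀ {xs ys : List A} → xs ↭ ys → Unique xs → Unique ys
unique-resp-↭ {A = A} σ = Unique-resp-↭ (↭⇒↭ₛ σ)
  where open import Data.List.Relation.Binary.Permutation.Setoid.Properties (setoid A) using (Unique-resp-↭)

same-members⇒↭ : ∀ {xs ys : List A} → Unique xs → Unique ys →
                 (∀ {x} → x ∈ xs → x ∈ ys) → (∀ {x} → x ∈ ys → x ∈ xs) → xs ↭ ys
same-members⇒↭ {xs = []} {[]}    _ _ _ _ = ↭-refl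
same-members⇒↭ {xs = []} {_ ∷ _} _ _ _ from with () ← from (here refl)
same-members⇒↭ {xs = x ∷ xs} (x∉xs ∷ uxs) uys to from
  with as , bs , refl ← ∈-∃++ (to (here refl)) =
  ↭-trans (prep x (same-members⇒↭ uxs (AllPairs.tail ux∷) to′ from′)) (↭-sym (shift x as bs))
  where
  ux∷ : Unique (x ∷ as ++ bs)
  ux∷ = unique-resp-↭ (shift x as bs) uys
  to′ : ∀ {y} → y ∈ xs → y ∈ as ++ bs
  to′ y∈xs with ∈-resp-↭ (shift x as bs) (to (there y∈xs))
  ... | here refl = ⊥-elim (All.lookup x∉xs y∈xs refl)
  ... | there y∈  = y∈
  from′ : ∀ {y} → y ∈ as ++ bs → y ∈ xs
  from′ y∈ with from (∈-resp-↭ (↭-sym (shift x as bs)) (there y∈))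
  ... | here refl  = ⊥-elim (All.lookup (AllPairs.head ux∷) y∈ refl)
  ... | there y∈xs = y∈xs

blocks-unique : ∀ {Φ : List (List A)} → Unique (concat Φ) →
                ∀ {T U v} → T ∈ Φ → U ∈ Φ → v ∈ T → v ∈ U → T ≡ U
blocks-unique         u (here refl) (here refl) _ _ = refl
blocks-unique {Φ = T ∷ Φ} u (here refl) (there U∈Φ) v∈T v∈U =
  ⊥-elim (unique-++-disjoint T u v∈T (∈-concat⁺′ v∈U U∈Φ))
blocks-unique {Φ = U ∷ Φ} u (there T∈Φ) (here refl) v∈T v∈U =
  ⊥-elim (unique-++-disjoint U u v∈U (∈-concat⁺′ v∈T T∈Φ))
blocks-unique {Φ = W ∷ Φ} u (there T∈Φ) (there U∈Φ) v∈T v∈U =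
  blocks-unique (unique-++ʳ W u) T∈Φ U∈Φ v∈T v∈U

concat-filter-nonempty : ∀ (xss : List (List A)) → concat (filter (λ xs → 1 ≤? length xs) xss) ≡ concat xss
concat-filter-nonempty []               = refl
concat-filter-nonempty ([] ∷ xss)       = concat-filter-nonempty xss
concat-filter-nonempty ((x ∷ xs) ∷ xss) = cong ((x ∷ xs) ++_) (concat-filter-nonempty xss)

concat-map-filter : ∀ {P : Pred A π} (P? : Decidable P) xss → concat (map (filter P?) xss) ≡ filter P? (concat xss)
concat-map-filter P? []         = refl
concat-map-filter P? (xs ∷ xss) =
  trans (cong (filter P? xs ++_) (concat-map-filter P? xss)) (sym (filter-++ P? xs (concat xss)))

∈⇒0<length : ∀ {x : A} {xs} → x ∈ xs → 0 < length xs
∈⇒0<length (here _)  = s≤s z≤n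
∈⇒0<length (there _) = s≤s z≤n

vertices⇒0< : ∀ {n} {xs : List (Fin n)} → 0 < length xs → 0 < n
vertices⇒0< {xs = Fin.zero  ∷ _} _ = s≤s z≤n
vertices⇒0< {xs = Fin.suc _ ∷ _} _ = s≤s z≤n

-- Maximal clique covers

module _ {ℓ : ℕ} (G : Graph ℓ) where

  private
    V = Fin ℓ
  open import Data.List.Membership.DecPropositional (Fin._≟_ {ℓ}) using (_∈?_; _∉?_)

  adjacent⇒distinct : ∀ {u v} → adj G u v ≡ true → u ≢ v
  adjacent⇒distinct {u} uv refl = contradiction (trans (sym uv) (irrefl G u)) λ ()

  clique⇒unique : ∀ {C} → IsClique G C → Unique C
  clique⇒unique = AllPairs.map adjacent⇒distinct

  cnt≡∑ : ∀ Φ m → cnt G Φ m ≡ ∑ (λ T → 𝟙 (length T ≟ m)) Φ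
  cnt≡∑ Φ m = length-filter≡∑ (λ T → length T ≟ m) Φ

  e≡∑ : ∀ A B → e G A B ≡ ∑ (λ v → degIn G v B) A
  e≡∑ []      B = refl
  e≡∑ (x ∷ A) B = cong (degIn G x B +_) (e≡∑ A B)

  degIn-concat : ∀ v Φ → degIn G v (concat Φ) ≡ ∑ (degIn G v) Φ
  degIn-concat v []      = refl
  degIn-concat v (T ∷ Φ) = begin
    degIn G v (T ++ concat Φ)                 ≡⟨ cong length (filter-++ (T? ∘ adj G v) T (concat Φ)) ⟩
    length (filterᵇ (adj G v) T ++ filterᵇ (adj G v) (concat Φ)) ≡⟨ length-++ (filterᵇ (adj G v) T) ⟩
    degIn G v T + degIn G v (concat Φ)        ≡⟨ cong (degIn G v T +_) (degIn-concat v Φ) ⟩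
    degIn G v T + ∑ (degIn G v) Φ             ∎
    where open ≡-Reasoning

  module _ {k Φ} (cover : IsCliqueCover G k Φ) where

    cover↭allFin : concat Φ ↭ allFin ℓ
    cover↭allFin = same-members⇒↭ (proj₁ (proj₂ cover)) (allFin⁺ ℓ) (λ _ → ∈-allFin _) λ {v} _ → proj₂ (proj₂ cover) v

    deg≡∑degIn : ∀ v → deg G v ≡ ∑ (degIn G v) Φ
    deg≡∑degIn v = trans (↭-length (filter-↭ (T? ∘ adj G v) (↭-sym cover↭allFin))) (degIn-concat v Φ)

    order≡∑length : ℓ ≡ ∑ length Φ
    order≡∑length = trans (sym (length-tabulate {n = ℓ} λ v → v))
                          (trans (↭-length (↭-sym cover↭allFin)) (length-concat Φ))

    blocks-disjoint : ∀ {T U v} → T ∈ Φ → U ∈ Φ → v ∈ T → v ∈ U → T ≡ U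
    blocks-disjoint = blocks-unique (proj₁ (proj₂ cover))

  -- Splitting off a clique C whose vertices only meet blocks of Φ smaller than C:
  -- C together with the remains of the other blocks is a lexicographically larger cover.
  module SplitOff {k Φ C} (cover : IsCliqueCover G k Φ) (clique : IsClique G C)
                  (nonempty : 1 ≤ length C) (bounded : length C ≤ k)
                  (smaller : ∀ {T v} → T ∈ Φ → v ∈ C → v ∈ T → length T < length C) where

    strip : List V → List V
    strip = filter (_∉? C)

    Ψ : List (List V)
    Ψ = C ∷ filter (λ T → 1 ≤? length T) (map strip Φ)

    concat-Ψ : concat Ψ ≡ C ++ strip (concat Φ)
    concat-Ψ = cong (C ++_) (trans (concat-filter-nonempty (map strip Φ)) (concat-map-filter (_∉? C) Φ))

    strip-valid : ∀ {T} → T ∈ Φ → IsClique G (strip T) × length (strip T) ≤ k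
    strip-valid {T} T∈Φ with cl , _ , le ← All.lookup (proj₁ cover) T∈Φ =
      AllPairs.filter⁺ (_∉? C) cl , ℕ.≤-trans (length-filter (_∉? C) T) le

    Ψ-valid : All (λ K → IsClique G K × 1 ≤ length K × length K ≤ k) Ψ
    Ψ-valid = (clique , nonempty , bounded) ∷ All.tabulate valid
      where
      valid : ∀ {T′} → T′ ∈ filter (λ T → 1 ≤? length T) (map strip Φ) →
              IsClique G T′ × 1 ≤ length T′ × length T′ ≤ k
      valid T′∈ with T′∈map , ne ← ∈-filter⁻ (λ T → 1 ≤? length T) T′∈ = stripped (∈-map⁻ strip T′∈map) ne
        where
        stripped : ∀ {T′} → ∃ (λ T → T ∈ Φ × T′ ≡ strip T) → 1 ≤ length T′ →
                   IsClique G T′ × 1 ≤ length T′ × length T′ ≤ k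
        stripped (T , T∈Φ , refl) ne = proj₁ (strip-valid T∈Φ) , ne , proj₂ (strip-valid T∈Φ)

    Ψ-cover : IsCliqueCover G k Ψ
    Ψ-cover = Ψ-valid , subst Unique (sym concat-Ψ) unique , covers
      where
      unique : Unique (C ++ strip (concat Φ))
      unique = Unique.++⁺ (clique⇒unique clique) (Unique.filter⁺ (_∉? C) (proj₁ (proj₂ cover)))
                          λ (v∈C , v∈strip) → proj₂ (∈-filter⁻ (_∉? C) {xs = concat Φ} v∈strip) v∈C
      covers : ∀ v → v ∈ concat Ψ
      covers v rewrite concat-Ψ with v ∈? C
      ... | yes v∈C = ∈-++⁺ˡ v∈C
      ... | no  v∉C = ∈-++⁺ʳ C (∈-filter⁺ (_∉? C) (proj₂ (proj₂ cover) v) v∉C)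

    strip-order : ∀ {m T} → length C ≤ m → T ∈ Φ → 𝟙 (length (strip T) ≟ m) ≡ 𝟙 (length T ≟ m)
    strip-order {m} {T} C≤m T∈Φ with any? (_∈? C) T
    ... | yes meets with v , v∈T , v∈C ← find meets =
      trans (𝟙-no (_ ≟ m) (ℕ.<⇒≢ (ℕ.≤-<-trans (length-filter (_∉? C) T) T<m)))
            (sym (𝟙-no (_ ≟ m) (ℕ.<⇒≢ T<m)))
      where T<m = ℕ.<-≤-trans (smaller T∈Φ v∈C v∈T) C≤m
    ... | no  avoids = cong (λ T′ → 𝟙 (length T′ ≟ m)) (filter-all (_∉? C) (All.¬Any⇒All¬ T avoids))

    cnt-Ψ : ∀ {m} → length C ≤ m → cnt G Ψ m ≡ 𝟙 (length C ≟ m) + cnt G Φ m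
    cnt-Ψ {m} C≤m = begin
      cnt G Ψ m                                                  ≡⟨ cnt≡∑ Ψ m ⟩
      𝟙 (length C ≟ m) + ∑ 𝟙≟m (filter (λ T → 1 ≤? length T) (map strip Φ))
        ≡⟨ cong (𝟙 (length C ≟ m) +_) (∑-filter (λ T → 1 ≤? length T) 𝟙≟m (map strip Φ) empty) ⟩
      𝟙 (length C ≟ m) + ∑ 𝟙≟m (map strip Φ)                  ≡⟨ cong (𝟙 (length C ≟ m) +_) (∑-map 𝟙≟m strip Φ) ⟩
      𝟙 (length C ≟ m) + ∑ (𝟙≟m ∘ strip) Φ                    ≡⟨ cong (𝟙 (length C ≟ m) +_) (∑-cong Φ (strip-order C≤m)) ⟩
      𝟙 (length C ≟ m) + ∑ 𝟙≟m Φ                              ≡⟨ cong (𝟙 (length C ≟ m) +_) (cnt≡∑ Φ m) ⟨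
      𝟙 (length C ≟ m) + cnt G Φ m                             ∎
      where
      open ≡-Reasoning
      𝟙≟m : List V → ℕ
      𝟙≟m T = 𝟙 (length T ≟ m)
      empty : ∀ {T} → T ∈ map strip Φ → ¬ 1 ≤ length T → 𝟙≟m T ≡ 0
      empty _ ¬ne = 𝟙-no (_ ≟ m) λ T≡m → ¬ne (ℕ.≤-trans nonempty (ℕ.≤-trans C≤m (ℕ.≤-reflexive (sym T≡m))))

    Ψ-greater : LexGreater G k Ψ Φ
    Ψ-greater = length C , nonempty , bounded , more , same
      where
      more : cnt G Φ (length C) < cnt G Ψ (length C)
      more = subst (cnt G Φ (length C) <_)
                   (sym (trans (cnt-Ψ ℕ.≤-refl) (cong (_+ cnt G Φ (length C)) (𝟙-yes (_ ≟ _) refl))))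
                   (ℕ.n<1+n _)
      same : ∀ m → length C < m → m ≤ k → cnt G Ψ m ≡ cnt G Φ m
      same m C<m _ = trans (cnt-Ψ (ℕ.<⇒≤ C<m)) (cong (_+ cnt G Φ m) (𝟙-no (_ ≟ m) (ℕ.<⇒≢ C<m)))

  no-clique-over-smaller-blocks : ∀ {k Φ C} → IsMaximalCliqueCover G k Φ → IsClique G C →
    1 ≤ length C → length C ≤ k → ¬ (∀ {T v} → T ∈ Φ → v ∈ C → v ∈ T → length T < length C)
  no-clique-over-smaller-blocks (cover , maximal) clique nonempty bounded smaller =
    maximal Ψ Ψ-cover Ψ-greater
    where open SplitOff cover clique nonempty bounded smaller

-- Edges between the blocks of a maximal cover

<⇒≤∸1 : ∀ {m n} → m < n → m ≤ n ∸ 1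
<⇒≤∸1 (s≤s m≤n) = m≤n

-- The most edges a block of order a can send to a block of order b in a maximal k-clique-cover;
-- for b = k the extra edge of a well-connected pair is counted separately.
edgeBound : ℕ → ℕ → ℕ → ℕ
edgeBound k a b with b ≟ k | a ≤? b
... | yes _ | _     = a * (k ∸ 1) ∸ 1
... | no  _ | yes _ = a * (b ∸ 1)
... | no  _ | no  _ = b * (a ∸ 1)

edgeBound-top : ∀ k a → edgeBound k a k ≡ a * (k ∸ 1) ∸ 1
edgeBound-top k a with k ≟ k
... | yes _  = refl
... | no k≢k = contradiction refl k≢k

edgeBound-≤ : ∀ {k a b} → b < k → a ≤ b → edgeBound k a b ≡ a * (b ∸ 1)
edgeBound-≤ {k} {a} {b} b<k a≤b with b ≟ k | a ≤? b
... | yes b≡k | _      = contradiction b≡k (ℕ.<⇒≢ b<k)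
... | no  _   | yes _  = refl
... | no  _   | no a≰b = contradiction a≤b a≰b

edgeBound-> : ∀ {k a b} → b < k → b < a → edgeBound k a b ≡ b * (a ∸ 1)
edgeBound-> {k} {a} {b} b<k b<a with b ≟ k | a ≤? b
... | yes b≡k | _     = contradiction b≡k (ℕ.<⇒≢ b<k)
... | no  _   | yes a≤b = contradiction a≤b (ℕ.<⇒≱ b<a)
... | no  _   | no  _ = refl

module _ {ℓ : ℕ} (G : Graph ℓ) where

  degIn≡∑ : ∀ v B → degIn G v B ≡ ∑ (λ u → 𝟙 (T? (adj G v u))) B
  degIn≡∑ v B = length-filter≡∑ (T? ∘ adj G v) B

  degIn≤length : ∀ v B → degIn G v B ≤ length B
  degIn≤length v B = length-filter (T? ∘ adj G v) B

  full-degree⇒adjacent : ∀ {v B} → degIn G v B ≡ length B → All (λ u → adj G v u ≡ true) B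
  full-degree⇒adjacent {v} {B} full = All.map (Equivalence.to T-≡)
    (subst (All (T ∘ adj G v)) (filter-complete (T? ∘ adj G v) full) (All.all-filter (T? ∘ adj G v) B))

  e-sym : ∀ A B → e G A B ≡ e G B A
  e-sym A B = begin
    e G A B                                       ≡⟨ e≡∑ G A B ⟩
    ∑ (λ v → degIn G v B) A                       ≡⟨ ∑-cong A (λ {v} _ → degIn≡∑ v B) ⟩
    ∑ (λ v → ∑ (λ u → 𝟙 (T? (adj G v u))) B) A   ≡⟨ ∑-swap (λ v u → 𝟙 (T? (adj G v u))) A B ⟩
    ∑ (λ u → ∑ (λ v → 𝟙 (T? (adj G v u))) A) B   ≡⟨ ∑-cong B (λ {u} _ → ∑-cong A λ {v} _ → cong (𝟙 ∘ T?) (Graph.sym G v u)) ⟩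
    ∑ (λ u → ∑ (λ v → 𝟙 (T? (adj G u v))) A) B   ≡⟨ ∑-cong B (λ {u} _ → degIn≡∑ u A) ⟨
    ∑ (λ u → degIn G u A) B                       ≡⟨ e≡∑ G B A ⟨
    e G B A                                       ∎
    where open ≡-Reasoning

  e-≤ : ∀ {A B c} → (∀ {v} → v ∈ A → degIn G v B ≤ c) → e G A B ≤ length A * c
  e-≤ {A} {B} {c} bound = ℕ.≤-trans (ℕ.≤-reflexive (e≡∑ G A B))
                                    (ℕ.≤-trans (∑-mono A bound) (ℕ.≤-reflexive (∑-const c A)))

  e-≡ : ∀ {A B c} → All (λ v → degIn G v B ≡ c) A → e G A B ≡ length A * c
  e-≡ {A} {B} {c} exact = trans (e≡∑ G A B) (trans (∑-cong A (All.lookup exact)) (∑-const c A))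

  module _ {k Φ} (maximal : IsMaximalCliqueCover G k Φ) where

    private
      cover = proj₁ maximal

    degIn-block< : ∀ {K T v} → K ∈ Φ → T ∈ Φ → v ∈ K → length K ≤ length T → length T < k →
                   degIn G v T < length T
    degIn-block< {K} {T} {v} K∈Φ T∈Φ v∈K K≤T T<k with ℕ.m≤n⇒m<n∨m≡n (degIn≤length v T)
    ... | inj₁ lt   = lt
    ... | inj₂ full = ⊥-elim (no-clique-over-smaller-blocks G maximal clique (s≤s z≤n) T<k smaller)
      where
      clique : IsClique G (v ∷ T)
      clique = full-degree⇒adjacent full ∷ proj₁ (All.lookup (proj₁ cover) T∈Φ)
      smaller : ∀ {U u} → U ∈ Φ → u ∈ v ∷ T → u ∈ U → length U < suc (length T)
      smaller U∈Φ (here refl) u∈U = s≤s (subst (λ W → length W ≤ length T) (blocks-disjoint G cover K∈Φ U∈Φ v∈K u∈U) K≤T)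
      smaller U∈Φ (there u∈T) u∈U = s≤s (ℕ.≤-reflexive (cong length (blocks-disjoint G cover U∈Φ T∈Φ u∈U u∈T)))

    clique-in-two-blocks : ∀ {X Y C a} → X ∈ Φ → Y ∈ Φ → length X ≡ a → length Y ≡ a → a < k →
                           IsClique G C → (∀ {v} → v ∈ C → v ∈ X ⊎ v ∈ Y) → length C ≤ a
    clique-in-two-blocks {X} {Y} {C} {a} X∈Φ Y∈Φ |X| |Y| a<k clique inside = ℕ.≮⇒≥ too-many
      where
      too-many : ¬ a < length C
      too-many a<C = no-clique-over-smaller-blocks G maximal (AllPairs.take⁺ (suc a) clique) (subst (1 ≤_) (sym |C′|) (s≤s z≤n))
                       (ℕ.≤-trans (ℕ.≤-reflexive |C′|) a<k) smaller
        where
        |C′| : length (take (suc a) C) ≡ suc a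
        |C′| = trans (length-take (suc a) C) (ℕ.m≤n⇒m⊓n≡m a<C)
        smaller : ∀ {T v} → T ∈ Φ → v ∈ take (suc a) C → v ∈ T → length T < length (take (suc a) C)
        smaller T∈Φ v∈C′ v∈T with inside (∈-take (suc a) C v∈C′)
        ... | inj₁ v∈X = subst (λ U → length U < length (take (suc a) C)) (blocks-disjoint G cover X∈Φ T∈Φ v∈X v∈T)
                               (ℕ.≤-reflexive (trans (cong suc |X|) (sym |C′|)))
        ... | inj₂ v∈Y = subst (λ U → length U < length (take (suc a) C)) (blocks-disjoint G cover Y∈Φ T∈Φ v∈Y v∈T)
                               (ℕ.≤-reflexive (trans (cong suc |Y|) (sym |C′|)))

    e-top : ∀ {K T} → length T ≡ k → ¬ OverConnected G K T →
            e G K T ≤ (length K * (k ∸ 1) ∸ 1) + 𝟙 (wellConnected? G K T)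
    e-top {K} {T} T≡k fair with wellConnected? G K T
    ... | yes wc = begin
      e G K T                        ≡⟨ e-≡ {K} {T} wc ⟩
      length K * (length T ∸ 1)      ≡⟨ cong (λ t → length K * (t ∸ 1)) T≡k ⟩
      length K * (k ∸ 1)             ≤⟨ ℕ.m≤n+m∸n _ 1 ⟩
      1 + (length K * (k ∸ 1) ∸ 1)   ≡⟨ ℕ.+-comm 1 _ ⟩
      (length K * (k ∸ 1) ∸ 1) + 1   ∎
      where open ℕ.≤-Reasoning
    ... | no ¬wc = ℕ.≤-trans (<⇒≤∸1 (ℕ.≰⇒> λ many → fair (full many , ¬wc))) (ℕ.m≤m+n _ 0)
      where full = ℕ.≤-trans (ℕ.≤-reflexive (cong (λ t → length K * (t ∸ 1)) T≡k))

    e-small : ∀ {K T} → K ∈ Φ → T ∈ Φ → length K < k → length T < k →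
              e G K T ≤ edgeBound k (length K) (length T)
    e-small {K} {T} K∈Φ T∈Φ K<k T<k with ℕ.≤-<-connex (length K) (length T)
    ... | inj₁ K≤T = begin
      e G K T                            ≤⟨ e-≤ {K} {T} (λ v∈K → <⇒≤∸1 (degIn-block< K∈Φ T∈Φ v∈K K≤T T<k)) ⟩
      length K * (length T ∸ 1)          ≡⟨ edgeBound-≤ T<k K≤T ⟨
      edgeBound k (length K) (length T)  ∎
      where open ℕ.≤-Reasoning
    ... | inj₂ T<K = begin
      e G K T                            ≡⟨ e-sym K T ⟩
      e G T K                            ≤⟨ e-≤ {T} {K} (λ v∈T → <⇒≤∸1 (degIn-block< T∈Φ K∈Φ v∈T (ℕ.<⇒≤ T<K) K<k)) ⟩
      length T * (length K ∸ 1)          ≡⟨ edgeBound-> T<k T<K ⟨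
      edgeBound k (length K) (length T)  ∎
      where open ℕ.≤-Reasoning

    e-block : ∀ {K T} → K ∈ Φ → T ∈ Φ → length K < k → (length T ≡ k → ¬ OverConnected G K T) →
              e G K T ≤ edgeBound k (length K) (length T) + 𝟙 (length T ≟ k) * 𝟙 (wellConnected? G K T)
    e-block {K} {T} K∈Φ T∈Φ K<k fair
      with ℕ.m≤n⇒m<n∨m≡n (proj₂ (proj₂ (All.lookup (proj₁ cover) T∈Φ)))
    ... | inj₂ T≡k = subst (e G K T ≤_) (sym (cong₂ _+_
            (trans (cong (edgeBound k (length K)) T≡k) (edgeBound-top k (length K)))
            (trans (cong (_* 𝟙 (wellConnected? G K T)) (𝟙-yes (length T ≟ k) T≡k)) (ℕ.*-identityˡ _))))
          (e-top {K} {T} T≡k (fair T≡k))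
    ... | inj₁ T<k = subst (e G K T ≤_) (sym (trans
            (cong (λ z → edgeBound k (length K) (length T) + z * 𝟙 (wellConnected? G K T)) (𝟙-no (length T ≟ k) (ℕ.<⇒≢ T<k)))
            (ℕ.+-identityʳ _)))
          (e-small K∈Φ T∈Φ K<k T<k)

    degree-budget : ∀ {K} → K ∈ Φ → length K < k → (∀ T → T ∈ ofOrder G Φ k → ¬ OverConnected G K T) →
                    ∑ (deg G) K ≤ ∑ (λ T → edgeBound k (length K) (length T)) Φ + length (Λ G Φ k K)
    degree-budget {K} K∈Φ K<k fair = begin
      ∑ (deg G) K                                           ≡⟨ ∑-cong K (λ {v} _ → deg≡∑degIn G cover v) ⟩
      ∑ (λ v → ∑ (degIn G v) Φ) K                           ≡⟨ ∑-swap (degIn G) K Φ ⟩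
      ∑ (λ T → ∑ (λ v → degIn G v T) K) Φ                   ≡⟨ ∑-cong Φ (λ {T} _ → e≡∑ G K T) ⟨
      ∑ (e G K) Φ
        ≤⟨ ∑-mono Φ (λ T∈Φ → e-block K∈Φ T∈Φ K<k λ T≡k → fair _ (∈-filter⁺ (λ T → length T ≟ k) T∈Φ T≡k)) ⟩
      ∑ (λ T → edgeBound k (length K) (length T) + 𝟙 (length T ≟ k) * 𝟙 (wellConnected? G K T)) Φ
        ≡⟨ ∑-+ _ _ Φ ⟩
      ∑ (λ T → edgeBound k (length K) (length T)) Φ + ∑ (λ T → 𝟙 (length T ≟ k) * 𝟙 (wellConnected? G K T)) Φ
        ≡⟨ cong (∑ (λ T → edgeBound k (length K) (length T)) Φ +_) Λ≡∑ ⟨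
      ∑ (λ T → edgeBound k (length K) (length T)) Φ + length (Λ G Φ k K) ∎
      where
      open ℕ.≤-Reasoning
      Λ≡∑ : length (Λ G Φ k K) ≡ ∑ (λ T → 𝟙 (length T ≟ k) * 𝟙 (wellConnected? G K T)) Φ
      Λ≡∑ = trans (length-filter≡∑ (wellConnected? G K) (ofOrder G Φ k))
                  (∑-filter-𝟙 (λ T → length T ≟ k) (𝟙 ∘ wellConnected? G K) Φ)

private
  -- ℕtoℚ n is fromℚᵘ (ι n) by definition
  ι : ℕ → ℚᵘ
  ι n = mkℚᵘ (ℤ.+ n) 0

  fromℚᵘ-+ : ∀ p q → ℚ.fromℚᵘ (p ℚᵘ.+ q) ≡ ℚ.fromℚᵘ p ℚ.+ ℚ.fromℚᵘ q
  fromℚᵘ-+ p q = ℚ.toℚᵘ-injective (ℚᵘ.≃-trans (ℚ.toℚᵘ-fromℚᵘ (p ℚᵘ.+ q)) (ℚᵘ.≃-sym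
    (ℚᵘ.≃-trans (ℚ.toℚᵘ-homo-+ (ℚ.fromℚᵘ p) (ℚ.fromℚᵘ q))
                (ℚᵘ.+-cong (ℚ.toℚᵘ-fromℚᵘ p) (ℚ.toℚᵘ-fromℚᵘ q)))))

  fromℚᵘ-* : ∀ p q → ℚ.fromℚᵘ (p ℚᵘ.* q) ≡ ℚ.fromℚᵘ p ℚ.* ℚ.fromℚᵘ q
  fromℚᵘ-* p q = ℚ.toℚᵘ-injective (ℚᵘ.≃-trans (ℚ.toℚᵘ-fromℚᵘ (p ℚᵘ.* q)) (ℚᵘ.≃-sym
    (ℚᵘ.≃-trans (ℚ.toℚᵘ-homo-* (ℚ.fromℚᵘ p) (ℚ.fromℚᵘ q))
                (ℚᵘ.*-cong (ℚ.toℚᵘ-fromℚᵘ p) (ℚ.toℚᵘ-fromℚᵘ q)))))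

ℕtoℚ-+ : ∀ m n → ℕtoℚ (m + n) ≡ ℕtoℚ m ℚ.+ ℕtoℚ n
ℕtoℚ-+ m n = trans (ℚ.fromℚᵘ-cong ι-+) (fromℚᵘ-+ (ι m) (ι n))
  where
  ring : ∀ x y → (x ℤ.+ y) ℤ.* ℤ.+ 1 ≡ (x ℤ.* ℤ.+ 1 ℤ.+ y ℤ.* ℤ.+ 1) ℤ.* ℤ.+ 1
  ring = solve-∀
  ι-+ : ι (m + n) ℚᵘ.≃ ι m ℚᵘ.+ ι n
  ι-+ = *≡* (trans (cong (ℤ._* ℤ.+ 1) (ℤ.pos-+ m n)) (ring (ℤ.+ m) (ℤ.+ n)))

ℕtoℚ-* : ∀ m n → ℕtoℚ (m * n) ≡ ℕtoℚ m ℚ.* ℕtoℚ n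
ℕtoℚ-* m n = trans (ℚ.fromℚᵘ-cong ι-*) (fromℚᵘ-* (ι m) (ι n))
  where
  ι-* : ι (m * n) ℚᵘ.≃ ι m ℚᵘ.* ι n
  ι-* = *≡* (cong (ℤ._* ℤ.+ 1) (ℤ.pos-* m n))

ℕtoℚ-∸ : ∀ {m n} → n ≤ m → ℕtoℚ (m ∸ n) ≡ ℕtoℚ m ℚ.- ℕtoℚ n
ℕtoℚ-∸ {m} {n} n≤m = begin
  ℕtoℚ (m ∸ n)                             ≡⟨ ℚ.+-identityʳ _ ⟨
  ℕtoℚ (m ∸ n) ℚ.+ 0ℚ                      ≡⟨ cong (ℕtoℚ (m ∸ n) ℚ.+_) (ℚ.+-inverseʳ (ℕtoℚ n)) ⟨
  ℕtoℚ (m ∸ n) ℚ.+ (ℕtoℚ n ℚ.- ℕtoℚ n)     ≡⟨ ℚ.+-assoc (ℕtoℚ (m ∸ n)) _ _ ⟨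
  (ℕtoℚ (m ∸ n) ℚ.+ ℕtoℚ n) ℚ.- ℕtoℚ n     ≡⟨ cong (ℚ._- ℕtoℚ n) (ℕtoℚ-+ (m ∸ n) n) ⟨
  ℕtoℚ (m ∸ n + n) ℚ.- ℕtoℚ n               ≡⟨ cong (λ x → ℕtoℚ x ℚ.- ℕtoℚ n) (ℕ.m∸n+n≡m n≤m) ⟩
  ℕtoℚ m ℚ.- ℕtoℚ n                        ∎
  where open ≡-Reasoning

ℕtoℚ-mono-≤ : ∀ {m n} → m ≤ n → ℕtoℚ m ℚ.≤ ℕtoℚ n
ℕtoℚ-mono-≤ {m} {n} m≤n = ℚ.toℚᵘ-cancel-≤
  (ℚᵘ.≤-respʳ-≃ (ℚᵘ.≃-sym (ℚ.toℚᵘ-fromℚᵘ (ι n))) (ℚᵘ.≤-respˡ-≃ (ℚᵘ.≃-sym (ℚ.toℚᵘ-fromℚᵘ (ι m)))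
    (*≤* (ℤ.*-monoʳ-≤-nonNeg (ℤ.+ 1) (ℤ.+≤+ m≤n)))))

ℕtoℚ-injective : ∀ {m n} → ℕtoℚ m ≡ ℕtoℚ n → m ≡ n
ℕtoℚ-injective {m} {n} eq = ℕ.≤-antisym (cancel (ℚ.≤-reflexive eq)) (cancel (ℚ.≤-reflexive (sym eq)))
  where
  cancel : ∀ {m n} → ℕtoℚ m ℚ.≤ ℕtoℚ n → m ≤ n
  cancel {m} {n} le = ℕ.≮⇒≥ λ n<m → ℚ.<-irrefl refl (ℚ.≤-<-trans le (ℚ.toℚᵘ-cancel-<
    (ℚᵘ.<-respʳ-≃ (ℚᵘ.≃-sym (ℚ.toℚᵘ-fromℚᵘ (ι m))) (ℚᵘ.<-respˡ-≃ (ℚᵘ.≃-sym (ℚ.toℚᵘ-fromℚᵘ (ι n)))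
      (ℚᵘ.*<* (ℤ.*-monoʳ-<-pos (ℤ.+ 1) (ℤ.+<+ n<m)))))))

frac-* : ∀ m {n} → 0 < n → frac m n ℚ.* ℕtoℚ n ≡ ℕtoℚ m
frac-* m {suc n} _ = trans (sym (fromℚᵘ-* (mkℚᵘ (ℤ.+ m) n) (ι (suc n)))) (ℚ.fromℚᵘ-cong cancel)
  where
  ring : ∀ x y → x ℤ.* y ℤ.* ℤ.+ 1 ≡ x ℤ.* (y ℤ.* ℤ.+ 1)
  ring = solve-∀
  cancel : mkℚᵘ (ℤ.+ m) n ℚᵘ.* ι (suc n) ℚᵘ.≃ ι m
  cancel = *≡* (ring (ℤ.+ m) (ℤ.+ suc n))

frac≡ℕtoℚ* : ∀ m {n} → 0 < n → frac m n ≡ ℕtoℚ m ℚ.* frac 1 n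
frac≡ℕtoℚ* m {suc n} _ = trans (ℚ.fromℚᵘ-cong split) (fromℚᵘ-* (ι m) (mkℚᵘ (ℤ.+ 1) n))
  where
  ring : ∀ x y → x ℤ.* (ℤ.+ 1 ℤ.* y) ≡ x ℤ.* ℤ.+ 1 ℤ.* y
  ring = solve-∀
  split : mkℚᵘ (ℤ.+ m) n ℚᵘ.≃ ι m ℚᵘ.* mkℚᵘ (ℤ.+ 1) n
  split = *≡* (ring (ℤ.+ m) (ℤ.+ suc n))

frac<⇒ℕtoℚ< : ∀ {m n r} → 0 < n → frac m n ℚ.< r → ℕtoℚ m ℚ.< r ℚ.* ℕtoℚ n
frac<⇒ℕtoℚ< {m} {suc n} {r} 0<n lt = ℚ.≤-<-trans (ℚ.≤-reflexive (sym (frac-* m 0<n)))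
  (ℚ.*-monoˡ-<-pos (ℕtoℚ (suc n)) {{ℚ.normalize-pos (suc n) 1}} lt)

≤⇒0≤- : ∀ {p q} → p ℚ.≤ q → 0ℚ ℚ.≤ q ℚ.- p
≤⇒0≤- {p} {q} p≤q = ℚ.≤-trans (ℚ.≤-reflexive (sym (ℚ.+-inverseʳ p))) (ℚ.+-monoˡ-≤ (ℚ.- p) p≤q)

half-nonneg : ∀ p → 0ℚ ℚ.≤ p ℚ.+ p → 0ℚ ℚ.≤ p
half-nonneg p 0≤2p with 0ℚ ℚ.≤? p
... | yes 0≤p = 0≤p
... | no  0≰p = ⊥-elim (ℚ.<-irrefl refl (ℚ.<-≤-trans (ℚ.+-mono-< (ℚ.≰⇒> 0≰p) (ℚ.≰⇒> 0≰p)) 0≤2p))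

∑ℚ : (A → ℚ) → List A → ℚ
∑ℚ f xs = foldr ℚ._+_ 0ℚ (map f xs)

∑ℚ-↭ : ∀ (f : A → ℚ) {xs ys} → xs ↭ ys → ∑ℚ f xs ≡ ∑ℚ f ys
∑ℚ-↭ f σ = foldr-commMonoid ℚ.+-0-isCommutativeMonoid (↭⇒↭ₛ (map⁺ f σ))
  where open import Data.List.Relation.Binary.Permutation.Setoid.Properties (setoid ℚ) using (foldr-commMonoid)

∑ℚ-nonneg : ∀ (f : A → ℚ) {xs} → All (λ x → 0ℚ ℚ.≤ f x) xs → 0ℚ ℚ.≤ ∑ℚ f xs
∑ℚ-nonneg f []       = ℚ.≤-refl
∑ℚ-nonneg f (p ∷ ps) = ℚ.+-mono-≤ p (∑ℚ-nonneg f ps)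

module Threshold (w : A → ℚ) where

  #≤ #≥ : ℚ → List A → ℕ
  #≤ τ = ∑ λ x → 𝟙 (w x ℚ.≤? ℚ.- τ)
  #≥ τ = ∑ λ x → 𝟙 (τ ℚ.≤? w x)

  Balanced : List A → Set
  Balanced xs = ∀ τ → 0ℚ ℚ.< τ → #≤ τ xs ≤ #≥ τ xs

  private
    lightest : ∀ x xs → ∃ λ m → m ∈ x ∷ xs × All (λ z → w m ℚ.≤ w z) (x ∷ xs)
    lightest x xs = Extremaℚ.argmin w x xs , argmin∈ ,
                    Extremaℚ.f[argmin]≤f[⊤] {f = w} x xs ∷ Extremaℚ.f[argmin]≤f[xs] {f = w} x xs
      where
      argmin∈ : Extremaℚ.argmin w x xs ∈ x ∷ xs
      argmin∈ with Extremaℚ.argmin-sel w x xs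
      ... | inj₁ ≡x  = here ≡x
      ... | inj₂ ∈xs = there ∈xs

    -- balance at τ = -w m provides the partner
    partner : ∀ {m xs} → m ∈ xs → w m ℚ.< 0ℚ → Balanced xs → ∃₂ λ y R → xs ↭ m ∷ y ∷ R × ℚ.- w m ℚ.≤ w y
    partner {m} {xs} m∈ m<0 bal = y , proj₁ (extract y∈R₁) , ↭-trans σ₁ (prep m (proj₂ (extract y∈R₁))) , heavy
      where
      δ = ℚ.- w m
      δ>0 : 0ℚ ℚ.< δ
      δ>0 = ℚ.neg-antimono-< m<0
      some-heavy : 0 < #≥ δ xs
      m-light : 1 ≤ 𝟙 (w m ℚ.≤? ℚ.- δ)
      m-light = ℕ.≤-reflexive (sym (𝟙-yes (w m ℚ.≤? ℚ.- δ) (ℚ.≤-reflexive (sym (neg-involutive (w m))))))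
      some-heavy = ℕ.<-≤-trans (ℕ.≤-trans m-light (∑-member (λ z → 𝟙 (w z ℚ.≤? ℚ.- δ)) m∈)) (bal δ δ>0)
      y-data = ∑-pos (λ z → 𝟙 (δ ℚ.≤? w z)) xs some-heavy
      y = proj₁ y-data
      heavy : δ ℚ.≤ w y
      heavy = 𝟙-pos (δ ℚ.≤? w y) (proj₂ (proj₂ y-data))
      R₁ = proj₁ (extract m∈)
      σ₁ = proj₂ (extract m∈)
      y∈R₁ : y ∈ R₁
      y∈R₁ with ∈-resp-↭ σ₁ (proj₁ (proj₂ y-data))
      ... | here y≡m = contradiction (ℚ.<-≤-trans δ>0 (subst (λ z → δ ℚ.≤ w z) y≡m heavy)) (ℚ.<-asym m<0)
      ... | there y∈ = y∈

    remove-pair : ∀ {xs m y R} → xs ↭ m ∷ y ∷ R → All (λ z → w m ℚ.≤ w z) xs → w m ℚ.< 0ℚ →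
                  ℚ.- w m ℚ.≤ w y → Balanced xs → Balanced R
    remove-pair {xs} {m} {y} {R} σ lightest m<0 heavy bal τ τ>0 with τ ℚ.≤? ℚ.- w m
    ... | yes τ≤δ = ℕ.+-cancelˡ-≤ 1 _ _ (begin
      1 + #≤ τ R
        ≡⟨ cong₂ (λ a b → a + (b + #≤ τ R)) (𝟙-yes (w m ℚ.≤? ℚ.- τ) m-light) (𝟙-no (w y ℚ.≤? ℚ.- τ) y-not-light) ⟨
      #≤ τ (m ∷ y ∷ R)                  ≡⟨ ∑-↭ _ σ ⟨
      #≤ τ xs                           ≤⟨ bal τ τ>0 ⟩
      #≥ τ xs                           ≡⟨ ∑-↭ _ σ ⟩
      #≥ τ (m ∷ y ∷ R)
        ≡⟨ cong₂ (λ a b → a + (b + #≥ τ R)) (𝟙-no (τ ℚ.≤? w m) m-not-heavy) (𝟙-yes (τ ℚ.≤? w y) y-heavy) ⟩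
      1 + #≥ τ R                        ∎)
      where
      open ℕ.≤-Reasoning
      m-light : w m ℚ.≤ ℚ.- τ
      m-light = subst (ℚ._≤ ℚ.- τ) (neg-involutive (w m)) (ℚ.neg-antimono-≤ τ≤δ)
      y-heavy : τ ℚ.≤ w y
      y-heavy = ℚ.≤-trans τ≤δ heavy
      m-not-heavy : ¬ τ ℚ.≤ w m
      m-not-heavy τ≤m = ℚ.<-irrefl refl (ℚ.<-trans (ℚ.<-≤-trans τ>0 τ≤m) m<0)
      y-not-light : ¬ w y ℚ.≤ ℚ.- τ
      y-not-light y≤-τ = ℚ.<-irrefl refl
        (ℚ.<-≤-trans (ℚ.<-≤-trans (ℚ.neg-antimono-< τ>0) (ℚ.<⇒≤ (ℚ.<-≤-trans τ>0 y-heavy))) y≤-τ)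
    ... | no δ≱τ = ℕ.≤-trans (ℕ.≤-reflexive (∑-zero R none)) z≤n
      where
      none : ∀ {z} → z ∈ R → 𝟙 (w z ℚ.≤? ℚ.- τ) ≡ 0
      none z∈R = 𝟙-no (w _ ℚ.≤? ℚ.- τ) λ z≤-τ → ℚ.<-irrefl refl (ℚ.≤-<-trans
        (All.lookup lightest (∈-resp-↭ (↭-sym σ) (there (there z∈R))))
        (ℚ.≤-<-trans z≤-τ (subst (ℚ.- τ ℚ.<_) (neg-involutive (w m)) (ℚ.neg-antimono-< (ℚ.≰⇒> δ≱τ)))))

  -- A lightest entry, if negative, pairs off with a partner at least as heavy as it is light.
  balanced⇒∑ℚ-nonneg : ∀ xs → Balanced xs → 0ℚ ℚ.≤ ∑ℚ w xs
  balanced⇒∑ℚ-nonneg xs = go (length xs) xs ℕ.≤-refl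
    where
    go : ∀ n xs → length xs ≤ n → Balanced xs → 0ℚ ℚ.≤ ∑ℚ w xs
    go _       []       _   _   = ℚ.≤-refl
    go (suc n) (x ∷ xs) len bal with m , m∈ , m-lightest ← lightest x xs | 0ℚ ℚ.≤? w m
    ... | yes m≥0 = ∑ℚ-nonneg w (All.map (ℚ.≤-trans m≥0) m-lightest)
    ... | no  m≱0 with y , R , σ , heavy ← partner m∈ (ℚ.≰⇒> m≱0) bal = begin
      0ℚ                          ≡⟨ ℚ.+-inverseʳ (w m) ⟨
      w m ℚ.+ ℚ.- w m             ≡⟨ ℚ.+-identityʳ _ ⟨
      w m ℚ.+ ℚ.- w m ℚ.+ 0ℚ      ≤⟨ ℚ.+-mono-≤ (ℚ.+-monoʳ-≤ (w m) heavy)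
                                                (go n R lenR (remove-pair σ m-lightest (ℚ.≰⇒> m≱0) heavy bal)) ⟩
      w m ℚ.+ w y ℚ.+ ∑ℚ w R      ≡⟨ ℚ.+-assoc (w m) (w y) (∑ℚ w R) ⟩
      ∑ℚ w (m ∷ y ∷ R)            ≡⟨ ∑ℚ-↭ w σ ⟨
      ∑ℚ w (x ∷ xs)               ∎
      where
      open ℚ.≤-Reasoning
      lenR : length R ≤ n
      lenR = ℕ.≤-pred (ℕ.≤-trans (ℕ.n≤1+n _) (ℕ.≤-trans (ℕ.≤-reflexive (↭-length (↭-sym σ))) len))

-- Two blocks of equal order

module _ {ℓ : ℕ} (G : Graph ℓ) {k Φ} (maximal : IsMaximalCliqueCover G k Φ) (H : ℚ)
         (ore : ∀ x y → x ≢ y → adj G x y ≡ false → H ℚ.≤ ℕtoℚ (deg G x) ℚ.+ ℕtoℚ (deg G y)) where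

  private
    cover = proj₁ maximal

    d : Fin ℓ → ℚ
    d v = ℕtoℚ (deg G v)

  -- opaque: unfolding w would make the unifier normalise rational arithmetic on open terms
  opaque
    w : Fin ℓ → ℚ
    w v = d v ℚ.+ d v ℚ.- H

    w-def : ∀ v → w v ≡ d v ℚ.+ d v ℚ.- H
    w-def v = refl

  private

    light⇒partner-heavy : ∀ {x y τ} → H ℚ.≤ d x ℚ.+ d y → w x ℚ.≤ ℚ.- τ → τ ℚ.≤ w y
    light⇒partner-heavy {x} {y} {τ} nonadjacent light = begin
      τ                        ≡⟨ neg-involutive τ ⟨
      ℚ.- ℚ.- τ                ≤⟨ ℚ.neg-antimono-≤ light ⟩
      ℚ.- w x                  ≡⟨ cong ℚ.-_ (w-def x) ⟩
      ℚ.- (d x ℚ.+ d x ℚ.- H)  ≡⟨ ℚ.+-identityʳ _ ⟨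
      ℚ.- (d x ℚ.+ d x ℚ.- H) ℚ.+ 0ℚ         ≤⟨ ℚ.+-monoʳ-≤ (ℚ.- (d x ℚ.+ d x ℚ.- H)) (ℚ.+-mono-≤ slack slack) ⟩
      ℚ.- (d x ℚ.+ d x ℚ.- H) ℚ.+ (u ℚ.+ u)  ≡⟨ solve 3 (λ a b h → :- (a :+ a :- h) :+ ((a :+ b :- h) :+ (a :+ b :- h)) := b :+ b :- h)
                                                      refl (d x) (d y) H ⟩
      d y ℚ.+ d y ℚ.- H                      ≡⟨ w-def y ⟨
      w y                                    ∎
      where
      open ℚ.≤-Reasoning
      open +-*-Solver
      u = d x ℚ.+ d y ℚ.- H
      slack = ≤⇒0≤- nonadjacent

  open Threshold w

  light≤heavy : ∀ {X Y a} → X ∈ Φ → Y ∈ Φ → X ≢ Y → length X ≡ a → length Y ≡ a → a < k →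
                ∀ τ → 0ℚ ℚ.< τ → #≤ τ X ≤ #≥ τ Y
  light≤heavy {X} {Y} {a} X∈Φ Y∈Φ X≢Y |X| |Y| a<k τ τ>0 = ℕ.+-cancelʳ-≤ (length Yc) _ _ (begin
    #≤ τ X + length Yc      ≡⟨ cong (_+ length Yc) (length-filter≡∑ light? X) ⟨
    length S + length Yc    ≤⟨ few ⟩
    a                       ≡⟨ |Y| ⟨
    length Y                ≤⟨ many ⟩
    #≥ τ Y + length Yc      ∎)
    where
    open ℕ.≤-Reasoning
    light? = λ x → w x ℚ.≤? ℚ.- τ
    S = filter light? X
    common? : ∀ y → Dec (All (λ x → adj G x y ≡ true) S)
    common? y = All.all? (λ x → adj G x y ≟ᵇ true) S
    Yc = filter common? Y

    few : length S + length Yc ≤ a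
    few = subst (_≤ a) (length-++ S) (clique-in-two-blocks G maximal X∈Φ Y∈Φ |X| |Y| a<k clique inside)
      where
      cross : All (λ x → All (λ y → adj G x y ≡ true) Yc) S
      cross = All.tabulate λ x∈S → All.tabulate λ y∈Yc → All.lookup (proj₂ (∈-filter⁻ common? {xs = Y} y∈Yc)) x∈S
      clique : IsClique G (S ++ Yc)
      clique = AllPairs.++⁺ (AllPairs.filter⁺ light? (proj₁ (All.lookup (proj₁ cover) X∈Φ)))
                            (AllPairs.filter⁺ common? (proj₁ (All.lookup (proj₁ cover) Y∈Φ))) cross
      inside : ∀ {v} → v ∈ S ++ Yc → v ∈ X ⊎ v ∈ Y
      inside v∈ with ∈-++⁻ S v∈
      ... | inj₁ v∈S  = inj₁ (proj₁ (∈-filter⁻ light? {xs = X} v∈S))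
      ... | inj₂ v∈Yc = inj₂ (proj₁ (∈-filter⁻ common? {xs = Y} v∈Yc))

    heavy-or-common : ∀ {y} → y ∈ Y → 1 ≤ 𝟙 (τ ℚ.≤? w y) + 𝟙 (common? y)
    heavy-or-common {y} y∈Y with common? y
    ... | yes _ = ℕ.m≤n+m 1 _
    ... | no ¬common with x , x∈S , ¬xy ← find (All.¬All⇒Any¬ (λ x → adj G x y ≟ᵇ true) S ¬common) =
      ℕ.≤-trans (ℕ.≤-reflexive (sym (𝟙-yes (τ ℚ.≤? w y) (light⇒partner-heavy (ore x y x≢y (¬-not ¬xy)) x-light))))
                (ℕ.m≤m+n _ 0)
      where
      x∈X,x-light = ∈-filter⁻ light? {xs = X} x∈S
      x-light = proj₂ x∈X,x-light
      x≢y : x ≢ y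
      x≢y refl = X≢Y (blocks-disjoint G cover X∈Φ Y∈Φ (proj₁ x∈X,x-light) y∈Y)

    many : length Y ≤ #≥ τ Y + length Yc
    many = begin
      length Y                                                 ≡⟨ ℕ.*-identityʳ _ ⟨
      length Y * 1                                             ≡⟨ ∑-const 1 Y ⟨
      ∑ (λ _ → 1) Y                                            ≤⟨ ∑-mono Y heavy-or-common ⟩
      ∑ (λ y → 𝟙 (τ ℚ.≤? w y) + 𝟙 (common? y)) Y             ≡⟨ ∑-+ _ _ Y ⟩
      #≥ τ Y + ∑ (𝟙 ∘ common?) Y                               ≡⟨ cong (#≥ τ Y +_) (length-filter≡∑ common? Y) ⟨
      #≥ τ Y + length Yc                                       ∎

  balanced-pair : ∀ {X Y a} → X ∈ Φ → Y ∈ Φ → X ≢ Y → length X ≡ a → length Y ≡ a → a < k → Balanced (X ++ Y)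
  balanced-pair {X} {Y} X∈Φ Y∈Φ X≢Y |X| |Y| a<k τ τ>0 = begin
    #≤ τ (X ++ Y)         ≡⟨ ∑-++ _ X Y ⟩
    #≤ τ X + #≤ τ Y       ≤⟨ ℕ.+-mono-≤ (light≤heavy X∈Φ Y∈Φ X≢Y |X| |Y| a<k τ τ>0)
                                        (light≤heavy Y∈Φ X∈Φ (X≢Y ∘ sym) |Y| |X| a<k τ τ>0) ⟩
    #≥ τ Y + #≥ τ X       ≡⟨ ℕ.+-comm (#≥ τ Y) _ ⟩
    #≥ τ X + #≥ τ Y       ≡⟨ ∑-++ _ X Y ⟨
    #≥ τ (X ++ Y)         ∎
    where open ℕ.≤-Reasoning

  ∑ℚ-w : ∀ xs → ∑ℚ w xs ≡ ℕtoℚ (∑ (deg G) xs) ℚ.+ ℕtoℚ (∑ (deg G) xs) ℚ.- ℕtoℚ (length xs) ℚ.* H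
  ∑ℚ-w [] = solve 1 (λ h → con 0ℚ := con 0ℚ :+ con 0ℚ :- con 0ℚ :* h) refl H
    where open +-*-Solver
  ∑ℚ-w (x ∷ xs) = begin
    w x ℚ.+ ∑ℚ w xs
      ≡⟨ cong₂ ℚ._+_ (w-def x) (∑ℚ-w xs) ⟩
    (d x ℚ.+ d x ℚ.- H) ℚ.+ (ℕtoℚ (∑ (deg G) xs) ℚ.+ ℕtoℚ (∑ (deg G) xs) ℚ.- ℕtoℚ (length xs) ℚ.* H)
      ≡⟨ solve 4 (λ dx D n h → (dx :+ dx :- h) :+ (D :+ D :- n :* h) := (dx :+ D) :+ (dx :+ D) :- (con 1ℚ :+ n) :* h)
               refl (d x) (ℕtoℚ (∑ (deg G) xs)) (ℕtoℚ (length xs)) H ⟩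
    (d x ℚ.+ ℕtoℚ (∑ (deg G) xs)) ℚ.+ (d x ℚ.+ ℕtoℚ (∑ (deg G) xs)) ℚ.- (1ℚ ℚ.+ ℕtoℚ (length xs)) ℚ.* H
      ≡⟨ cong₂ (λ D n → D ℚ.+ D ℚ.- n ℚ.* H) (ℕtoℚ-+ (deg G x) _) (ℕtoℚ-+ 1 (length xs)) ⟨
    ℕtoℚ (∑ (deg G) (x ∷ xs)) ℚ.+ ℕtoℚ (∑ (deg G) (x ∷ xs)) ℚ.- ℕtoℚ (length (x ∷ xs)) ℚ.* H ∎
    where
    open ≡-Reasoning
    open +-*-Solver

  degree-sum-two-blocks : ∀ {X Y a} → X ∈ Φ → Y ∈ Φ → X ≢ Y → length X ≡ a → length Y ≡ a → a < k →
            ℕtoℚ a ℚ.* H ℚ.≤ ℕtoℚ (∑ (deg G) X + ∑ (deg G) Y)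
  degree-sum-two-blocks {X} {Y} {a} X∈Φ Y∈Φ X≢Y |X| |Y| a<k = begin
    ℕtoℚ a ℚ.* H                           ≡⟨ ℚ.+-identityˡ _ ⟨
    0ℚ ℚ.+ ℕtoℚ a ℚ.* H                    ≤⟨ ℚ.+-monoˡ-≤ (ℕtoℚ a ℚ.* H) (half-nonneg (D ℚ.- ℕtoℚ a ℚ.* H) twice) ⟩
    (D ℚ.- ℕtoℚ a ℚ.* H) ℚ.+ ℕtoℚ a ℚ.* H ≡⟨ solve 2 (λ D aH → (D :- aH) :+ aH := D) refl D (ℕtoℚ a ℚ.* H) ⟩
    D                                      ∎
    where
    open ℚ.≤-Reasoning
    open +-*-Solver
    D = ℕtoℚ (∑ (deg G) X + ∑ (deg G) Y)
    ∑w : ∑ℚ w (X ++ Y) ≡ (D ℚ.- ℕtoℚ a ℚ.* H) ℚ.+ (D ℚ.- ℕtoℚ a ℚ.* H)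
    ∑w = begin-equality
      ∑ℚ w (X ++ Y) ≡⟨ ∑ℚ-w (X ++ Y) ⟩
      ℕtoℚ (∑ (deg G) (X ++ Y)) ℚ.+ ℕtoℚ (∑ (deg G) (X ++ Y)) ℚ.- ℕtoℚ (length (X ++ Y)) ℚ.* H
        ≡⟨ cong₂ (λ D n → D ℚ.+ D ℚ.- n ℚ.* H) (cong ℕtoℚ (∑-++ (deg G) X Y))
                 (trans (cong ℕtoℚ (trans (length-++ X) (cong₂ _+_ |X| |Y|))) (ℕtoℚ-+ a a)) ⟩
      D ℚ.+ D ℚ.- (ℕtoℚ a ℚ.+ ℕtoℚ a) ℚ.* H
        ≡⟨ solve 3 (λ D A h → D :+ D :- (A :+ A) :* h := (D :- A :* h) :+ (D :- A :* h)) refl D (ℕtoℚ a) H ⟩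
      (D ℚ.- ℕtoℚ a ℚ.* H) ℚ.+ (D ℚ.- ℕtoℚ a ℚ.* H) ∎
    twice : 0ℚ ℚ.≤ (D ℚ.- ℕtoℚ a ℚ.* H) ℚ.+ (D ℚ.- ℕtoℚ a ℚ.* H)
    twice = ℚ.≤-trans (balanced⇒∑ℚ-nonneg (X ++ Y) (balanced-pair X∈Φ Y∈Φ X≢Y |X| |Y| a<k)) (ℚ.≤-reflexive ∑w)

open import Data.List.Membership.DecPropositional _≟_ using () renaming (_∈?_ to _∈ℕ?_)

interval : ℕ → ℕ → List ℕ
interval p q = map (p +_) (upTo (suc q ∸ p))

∈-interval⁺ : ∀ {p q x} → p ≤ x → x ≤ q → x ∈ interval p q
∈-interval⁺ {p} {q} {x} p≤x x≤q = subst (_∈ interval p q) (ℕ.m+[n∸m]≡n p≤x)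
  (∈-map⁺ (p +_) (∈-upTo⁺ (ℕ.∸-monoˡ-< (s≤s x≤q) p≤x)))

∈-interval⁻ : ∀ {p q x} → x ∈ interval p q → p ≤ x × x ≤ q
∈-interval⁻ {p} {q} x∈ with t , t∈ , refl ← ∈-map⁻ (p +_) x∈ =
  ℕ.m≤m+n p t , ℕ.≤-pred (ℕ.≤-trans (ℕ.+-monoʳ-< p t<) (ℕ.≤-reflexive (ℕ.m+[n∸m]≡n (ℕ.<⇒≤ p<1+q))))
  where
  t< : t < suc q ∸ p
  t< = ∈-upTo⁻ t∈
  p<1+q : p < suc q
  p<1+q = ℕ.m∸n≢0⇒n<m (ℕ.<⇒≢ (ℕ.≤-<-trans z≤n t<) ∘ sym)

interval-unique : ∀ p q → Unique (interval p q)
interval-unique p q = Unique.map⁺ (ℕ.+-cancelˡ-≡ p _ _) (upTo⁺ (suc q ∸ p))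

∑-cast : ∀ (g : ℕ → ℚ) (c : ℕ → ℕ) L → (∀ j → g j ℚ.* L ≡ ℕtoℚ (c j)) →
         ∀ js → foldr (λ j acc → g j ℚ.+ acc) 0ℚ js ℚ.* L ≡ ℕtoℚ (∑ c js)
∑-cast g c L gL []       = ℚ.*-zeroˡ L
∑-cast g c L gL (j ∷ js) = begin
  (g j ℚ.+ foldr (λ j acc → g j ℚ.+ acc) 0ℚ js) ℚ.* L          ≡⟨ ℚ.*-distribʳ-+ L (g j) _ ⟩
  g j ℚ.* L ℚ.+ foldr (λ j acc → g j ℚ.+ acc) 0ℚ js ℚ.* L      ≡⟨ cong₂ ℚ._+_ (gL j) (∑-cast g c L gL js) ⟩
  ℕtoℚ (c j) ℚ.+ ℕtoℚ (∑ c js)                                  ≡⟨ ℕtoℚ-+ (c j) (∑ c js) ⟨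
  ℕtoℚ (∑ c (j ∷ js))                                           ∎
  where open ≡-Reasoning

count-∈ : ∀ {x} {xs : List ℕ} → Unique xs → x ∈ xs → ∑ (λ j → 𝟙 (j ≟ x)) xs ≡ 1
count-∈ {x} {xs = _ ∷ xs} (x∉ ∷ _) (here refl) =
  cong₂ _+_ (𝟙-yes (x ≟ x) refl) (∑-zero xs λ j∈ → 𝟙-no (_ ≟ x) λ { refl → All.lookup x∉ j∈ refl })
count-∈ {x} {xs = y ∷ xs} (y∉ ∷ u) (there x∈) =
  cong₂ _+_ (𝟙-no (y ≟ x) λ { refl → All.lookup y∉ x∈ refl }) (count-∈ u x∈)

count-∉ : ∀ {x} (xs : List ℕ) → x ∉ xs → ∑ (λ j → 𝟙 (j ≟ x)) xs ≡ 0
count-∉ {x} xs x∉ = ∑-zero xs λ j∈ → 𝟙-no (_ ≟ x) λ { refl → x∉ j∈ }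

module _ {ℓ : ℕ} (G : Graph ℓ) (k : ℕ) {Φ : List (List (Fin ℓ))} (orders : All (λ T → length T ≤ k) Φ) where

  ∑-by-coorder : ∀ (c : ℕ → ℕ) js → Unique js → All (_≤ k) js →
                 ∑ (λ j → c j * cnt G Φ (k ∸ j)) js ≡ ∑ (λ T → 𝟙 (k ∸ length T ∈ℕ? js) * c (k ∸ length T)) Φ
  ∑-by-coorder c js unique small = begin
    ∑ (λ j → c j * cnt G Φ (k ∸ j)) js
      ≡⟨ ∑-cong js (λ {j} _ → trans (cong (c j *_) (cnt≡∑ G Φ (k ∸ j))) (sym (∑-*ˡ (c j) _ Φ))) ⟩
    ∑ (λ j → ∑ (λ T → c j * 𝟙 (length T ≟ k ∸ j)) Φ) js
      ≡⟨ ∑-swap (λ j T → c j * 𝟙 (length T ≟ k ∸ j)) js Φ ⟩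
    ∑ (λ T → ∑ (λ j → c j * 𝟙 (length T ≟ k ∸ j)) js) Φ
      ≡⟨ ∑-cong Φ (λ {T} T∈Φ → per-block {T} (All.lookup orders T∈Φ)) ⟩
    ∑ (λ T → 𝟙 (k ∸ length T ∈ℕ? js) * c (k ∸ length T)) Φ ∎
    where
    open ≡-Reasoning
    per-block : ∀ {T} → length T ≤ k →
                ∑ (λ j → c j * 𝟙 (length T ≟ k ∸ j)) js ≡ 𝟙 (k ∸ length T ∈ℕ? js) * c (k ∸ length T)
    per-block {T} T≤k = begin
      ∑ (λ j → c j * 𝟙 (length T ≟ k ∸ j)) js
        ≡⟨ ∑-cong js (λ j∈ → point (All.lookup small j∈)) ⟩
      ∑ (λ j → 𝟙 (j ≟ k ∸ length T) * c (k ∸ length T)) js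
        ≡⟨ trans (∑-cong js λ {j} _ → ℕ.*-comm (𝟙 (j ≟ k ∸ length T)) _) (∑-*ˡ (c (k ∸ length T)) _ js) ⟩
      c (k ∸ length T) * ∑ (λ j → 𝟙 (j ≟ k ∸ length T)) js
        ≡⟨ trans (cong (c (k ∸ length T) *_) (occurrences (k ∸ length T ∈ℕ? js))) (ℕ.*-comm (c (k ∸ length T)) _) ⟩
      𝟙 (k ∸ length T ∈ℕ? js) * c (k ∸ length T) ∎
      where
      occurrences : ∀ {x} (x∈? : Dec (x ∈ js)) → ∑ (λ j → 𝟙 (j ≟ x)) js ≡ 𝟙 x∈?
      occurrences (yes x∈) = count-∈ unique x∈
      occurrences (no  x∉) = count-∉ js x∉
      point : ∀ {j} → j ≤ k → c j * 𝟙 (length T ≟ k ∸ j) ≡ 𝟙 (j ≟ k ∸ length T) * c (k ∸ length T)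
      point {j} j≤k with j ≟ k ∸ length T
      ... | yes refl = trans (cong (c j *_) (𝟙-yes (length T ≟ k ∸ j) (sym (ℕ.m∸[m∸n]≡n T≤k)))) (ℕ.*-comm (c j) 1)
      ... | no  j≢   = trans (cong (c j *_) (𝟙-no (length T ≟ k ∸ j)
                                   λ T≡ → j≢ (trans (sym (ℕ.m∸[m∸n]≡n j≤k)) (cong (k ∸_) (sym T≡)))))
                             (ℕ.*-zeroʳ (c j))

-- The counting identity

∑-linearˡ : ∀ i₁ k₁ (z x₂ x₃ h : A → ℕ) xs →
            ∑ (λ x → i₁ * z x + k₁ * (x₂ x + i₁ * x₃ x + h x)) xs ≡
            i₁ * ∑ z xs + k₁ * (∑ x₂ xs + i₁ * ∑ x₃ xs + ∑ h xs)
∑-linearˡ i₁ k₁ z x₂ x₃ h xs =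
  trans (∑-+ _ _ xs) (cong₂ _+_ (∑-*ˡ i₁ z xs) (trans (∑-*ˡ k₁ _ xs) (cong (k₁ *_)
    (trans (∑-+ _ h xs) (cong (_+ ∑ h xs) (trans (∑-+ x₂ _ xs) (cong (∑ x₂ xs +_) (∑-*ˡ i₁ x₃ xs))))))))

∑-linearʳ : ∀ c i₁ (b x₁ : A → ℕ) xs → ∑ (λ x → c * b x + i₁ * x₁ x) xs ≡ c * ∑ b xs + i₁ * ∑ x₁ xs
∑-linearʳ c i₁ b x₁ xs = trans (∑-+ _ _ xs) (cong₂ _+_ (∑-*ˡ c b xs) (∑-*ˡ i₁ x₁ xs))

castˡ : ∀ i₁ z k₁ x₂ x₃ h → ℕtoℚ (i₁ * z + k₁ * (x₂ + i₁ * x₃ + h)) ≡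
        ℕtoℚ i₁ ℚ.* ℕtoℚ z ℚ.+ ℕtoℚ k₁ ℚ.* (ℕtoℚ x₂ ℚ.+ ℕtoℚ i₁ ℚ.* ℕtoℚ x₃ ℚ.+ ℕtoℚ h)
castˡ i₁ z k₁ x₂ x₃ h =
  trans (ℕtoℚ-+ (i₁ * z) _) (cong₂ ℚ._+_ (ℕtoℚ-* i₁ z) (trans (ℕtoℚ-* k₁ _) (cong (ℕtoℚ k₁ ℚ.*_)
    (trans (ℕtoℚ-+ (x₂ + i₁ * x₃) h) (cong (ℚ._+ ℕtoℚ h)
      (trans (ℕtoℚ-+ x₂ (i₁ * x₃)) (cong (ℕtoℚ x₂ ℚ.+_) (ℕtoℚ-* i₁ x₃))))))))

castʳ : ∀ a k₂ b i₁ x₁ →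
        ℕtoℚ (a * k₂ * b + i₁ * x₁) ≡ ℕtoℚ a ℚ.* ℕtoℚ k₂ ℚ.* ℕtoℚ b ℚ.+ ℕtoℚ i₁ ℚ.* ℕtoℚ x₁
castʳ a k₂ b i₁ x₁ = trans (ℕtoℚ-+ (a * k₂ * b) _)
  (cong₂ ℚ._+_ (trans (ℕtoℚ-* (a * k₂) b) (cong (ℚ._* ℕtoℚ b) (ℕtoℚ-* a k₂))) (ℕtoℚ-* i₁ x₁))

-- Truncated subtraction is dealt with by proving identities of this shape between the rational casts.
via-ℚ : ∀ {i₁ z k₁ x₂ x₃ h a k₂ b x₁} {I₁ Z K₁ X₂ X₃ Hq A K₂ B X₁ : ℚ} →
        ℕtoℚ i₁ ≡ I₁ → ℕtoℚ z ≡ Z → ℕtoℚ k₁ ≡ K₁ → ℕtoℚ x₂ ≡ X₂ → ℕtoℚ x₃ ≡ X₃ → ℕtoℚ h ≡ Hq →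
        ℕtoℚ a ≡ A → ℕtoℚ k₂ ≡ K₂ → ℕtoℚ b ≡ B → ℕtoℚ x₁ ≡ X₁ →
        I₁ ℚ.* Z ℚ.+ K₁ ℚ.* (X₂ ℚ.+ I₁ ℚ.* X₃ ℚ.+ Hq) ≡ A ℚ.* K₂ ℚ.* B ℚ.+ I₁ ℚ.* X₁ →
        i₁ * z + k₁ * (x₂ + i₁ * x₃ + h) ≡ a * k₂ * b + i₁ * x₁
via-ℚ {i₁} {z} {k₁} {x₂} {x₃} {h} {a} {k₂} {b} {x₁} refl refl refl refl refl refl refl refl refl refl eq =
  ℕtoℚ-injective (trans (castˡ i₁ z k₁ x₂ x₃ h) (trans eq (sym (castʳ a k₂ b i₁ x₁))))

module Counting (k i i₀ : ℕ) (2≤k : 2 ≤ k) (1≤i : 1 ≤ i) (i≤q₀ : i ≤ k ∸ i₀) (0<i₀ : 0 < i₀) (i₀<k : i₀ < k) where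

  a q₀ : ℕ
  a  = k ∸ i
  q₀ = k ∸ i₀

  q₀<k : q₀ < k
  q₀<k = ℕ.∸-monoʳ-< 0<i₀ (ℕ.<⇒≤ i₀<k)

  i<k : i < k
  i<k = ℕ.≤-<-trans i≤q₀ q₀<k

  0<a : 0 < a
  0<a = ℕ.m<n⇒0<n∸m i<k

  a<k : a < k
  a<k = ℕ.∸-monoʳ-< 1≤i (ℕ.<⇒≤ i<k)

  -- weight of a block of order b in (sumRange p q λ j → c j · φ (k ∸ j)) · ℓ
  weight : ℕ → ℕ → (ℕ → ℕ) → ℕ → ℕ
  weight p q c b = 𝟙 (k ∸ b ∈ℕ? interval p q) * c (k ∸ b)

  weight-in : ∀ {p q c b} → p ≤ k ∸ b → k ∸ b ≤ q → weight p q c b ≡ c (k ∸ b)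
  weight-in {p} {q} {c} {b} p≤ ≤q =
    trans (cong (_* c (k ∸ b)) (𝟙-yes (k ∸ b ∈ℕ? interval p q) (∈-interval⁺ p≤ ≤q))) (ℕ.*-identityˡ _)

  weight-out : ∀ {p q c b} → ¬ (p ≤ k ∸ b × k ∸ b ≤ q) → weight p q c b ≡ 0
  weight-out {p} {q} {c} {b} out = cong (_* c (k ∸ b)) (𝟙-no (k ∸ b ∈ℕ? interval p q) (out ∘ ∈-interval⁻))

  weight-pred : ∀ {q b} → 1 ≤ k ∸ b → k ∸ b ≤ q → weight 2 q (_∸ 1) b ≡ k ∸ b ∸ 1
  weight-pred {q} {b} 1≤j j≤q with ℕ.m≤n⇒m<n∨m≡n 1≤j
  ... | inj₁ 2≤j = weight-in {2} {q} {_∸ 1} {b} 2≤j j≤q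
  ... | inj₂ 1≡j = trans (weight-out {2} {q} {_∸ 1} {b} λ (2≤j , _) → ℕ.<-irrefl 1≡j 2≤j) (cong (_∸ 1) 1≡j)

  left right : ℕ → ℕ
  left b = (i ∸ 1) * 𝟙 (b ≟ k) + (k ∸ 1) * (weight 2 i (_∸ 1) b + (i ∸ 1) * weight (suc i) q₀ (λ _ → 1) b + edgeBound k a b)
  right b = a * (k ∸ 2) * b + (i ∸ 1) * weight 2 q₀ (_∸ 1) b

  private
    K I : ℚ
    K = ℕtoℚ k
    I = ℕtoℚ i

    i-1 : ℕtoℚ (i ∸ 1) ≡ I ℚ.- 1ℚ
    i-1 = ℕtoℚ-∸ 1≤i
    k-1 : ℕtoℚ (k ∸ 1) ≡ K ℚ.- 1ℚ
    k-1 = ℕtoℚ-∸ (ℕ.≤-trans (s≤s z≤n) 2≤k)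
    k-2 : ℕtoℚ (k ∸ 2) ≡ K ℚ.- ℕtoℚ 2
    k-2 = ℕtoℚ-∸ 2≤k
    k-i : ℕtoℚ a ≡ K ℚ.- I
    k-i = ℕtoℚ-∸ (ℕ.<⇒≤ i<k)
    k-b-1 : ∀ {b} → b < k → ℕtoℚ (k ∸ b ∸ 1) ≡ K ℚ.- ℕtoℚ b ℚ.- 1ℚ
    k-b-1 {b} b<k = trans (ℕtoℚ-∸ (ℕ.m<n⇒0<n∸m b<k)) (cong (ℚ._- 1ℚ) (ℕtoℚ-∸ (ℕ.<⇒≤ b<k)))

    by-ℚ : ∀ {b} {Z X₂ X₃ Hq X₁ : ℚ} →
           ℕtoℚ (𝟙 (b ≟ k)) ≡ Z → ℕtoℚ (weight 2 i (_∸ 1) b) ≡ X₂ → ℕtoℚ (weight (suc i) q₀ (λ _ → 1) b) ≡ X₃ →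
           ℕtoℚ (edgeBound k a b) ≡ Hq → ℕtoℚ (weight 2 q₀ (_∸ 1) b) ≡ X₁ →
           (I ℚ.- 1ℚ) ℚ.* Z ℚ.+ (K ℚ.- 1ℚ) ℚ.* (X₂ ℚ.+ (I ℚ.- 1ℚ) ℚ.* X₃ ℚ.+ Hq) ≡
             (K ℚ.- I) ℚ.* (K ℚ.- ℕtoℚ 2) ℚ.* ℕtoℚ b ℚ.+ (I ℚ.- 1ℚ) ℚ.* X₁ →
           left b ≡ right b
    by-ℚ {b} eZ eX₂ eX₃ eH eX₁ =
      via-ℚ {i ∸ 1} {𝟙 (b ≟ k)} {k ∸ 1} {weight 2 i (_∸ 1) b} {weight (suc i) q₀ (λ _ → 1) b} {edgeBound k a b}
            {a} {k ∸ 2} {b} {weight 2 q₀ (_∸ 1) b} i-1 eZ k-1 eX₂ eX₃ eH k-i k-2 refl eX₁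

  per-clique-top : left k ≡ right k
  per-clique-top = by-ℚ {k} (cong ℕtoℚ (𝟙-yes (k ≟ k) refl))
      (cong ℕtoℚ (weight-out {2} {i} {_∸ 1} {k} (λ (2≤0 , _) → absurd 2≤0)))
      (cong ℕtoℚ (weight-out {suc i} {q₀} {λ _ → 1} {k} λ (1+i≤0 , _) → absurd 1+i≤0)) edge
      (cong ℕtoℚ (weight-out {2} {q₀} {_∸ 1} {k} λ (2≤0 , _) → absurd 2≤0))
      (solve 2 (λ K I → (I :- con 1ℚ) :* con 1ℚ
                        :+ (K :- con 1ℚ) :* (con 0ℚ :+ (I :- con 1ℚ) :* con 0ℚ :+ ((K :- I) :* (K :- con 1ℚ) :- con 1ℚ))
                      := (K :- I) :* (K :- con (ℕtoℚ 2)) :* K :+ (I :- con 1ℚ) :* con 0ℚ) refl K I)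
    where
    open +-*-Solver
    absurd : ∀ {m} → suc m ≤ k ∸ k → ⊥
    absurd {m} le = contradiction (ℕ.≤-trans le (ℕ.≤-reflexive (ℕ.n∸n≡0 k))) λ ()
    edge : ℕtoℚ (edgeBound k a k) ≡ (K ℚ.- I) ℚ.* (K ℚ.- 1ℚ) ℚ.- 1ℚ
    edge = trans (cong ℕtoℚ (edgeBound-top k a))
                 (trans (ℕtoℚ-∸ (ℕ.*-mono-≤ 0<a (ℕ.m<n⇒0<n∸m (ℕ.≤-trans (s≤s (s≤s z≤n)) 2≤k))))
                        (cong (ℚ._- 1ℚ) (trans (ℕtoℚ-* a (k ∸ 1)) (cong₂ ℚ._*_ k-i k-1))))

  per-clique-upper : ∀ {b} → a ≤ b → b < k → left b ≡ right b
  per-clique-upper {b} a≤b b<k = by-ℚ {b} (cong ℕtoℚ (𝟙-no (b ≟ k) (ℕ.<⇒≢ b<k)))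
      (trans (cong ℕtoℚ (weight-pred {i} {b} 1≤j j≤i)) (k-b-1 b<k))
      (cong ℕtoℚ (weight-out {suc i} {q₀} {λ _ → 1} {b} λ (1+i≤j , _) → ℕ.<-irrefl refl (ℕ.<-≤-trans 1+i≤j j≤i)))
      edge (trans (cong ℕtoℚ (weight-pred {q₀} {b} 1≤j (ℕ.≤-trans j≤i i≤q₀))) (k-b-1 b<k))
      (solve 3 (λ K I B → (I :- con 1ℚ) :* con 0ℚ
                          :+ (K :- con 1ℚ) :* ((K :- B :- con 1ℚ) :+ (I :- con 1ℚ) :* con 0ℚ :+ (K :- I) :* (B :- con 1ℚ))
                        := (K :- I) :* (K :- con (ℕtoℚ 2)) :* B :+ (I :- con 1ℚ) :* (K :- B :- con 1ℚ)) refl K I (ℕtoℚ b))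
    where
    open +-*-Solver
    1≤j : 1 ≤ k ∸ b
    1≤j = ℕ.m<n⇒0<n∸m b<k
    j≤i : k ∸ b ≤ i
    j≤i = ℕ.≤-trans (ℕ.∸-monoʳ-≤ k a≤b) (ℕ.≤-reflexive (ℕ.m∸[m∸n]≡n (ℕ.<⇒≤ i<k)))
    edge : ℕtoℚ (edgeBound k a b) ≡ (K ℚ.- I) ℚ.* (ℕtoℚ b ℚ.- 1ℚ)
    edge = trans (cong ℕtoℚ (edgeBound-≤ b<k a≤b))
                 (trans (ℕtoℚ-* a (b ∸ 1)) (cong₂ ℚ._*_ k-i (ℕtoℚ-∸ (ℕ.≤-trans 0<a a≤b))))

  per-clique-lower : ∀ {b} → i₀ ≤ b → b < a → left b ≡ right b
  per-clique-lower {b} i₀≤b b<a = by-ℚ {b} (cong ℕtoℚ (𝟙-no (b ≟ k) (ℕ.<⇒≢ b<k)))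
      (cong ℕtoℚ (weight-out {2} {i} {_∸ 1} {b} λ (_ , j≤i) → ℕ.<-irrefl refl (ℕ.<-≤-trans i<j j≤i)))
      (cong ℕtoℚ (weight-in {suc i} {q₀} {λ _ → 1} {b} i<j j≤q₀))
      edge (trans (cong ℕtoℚ (weight-pred {q₀} {b} (ℕ.≤-trans (s≤s z≤n) i<j) j≤q₀)) (k-b-1 b<k))
      (solve 3 (λ K I B → (I :- con 1ℚ) :* con 0ℚ
                          :+ (K :- con 1ℚ) :* (con 0ℚ :+ (I :- con 1ℚ) :* con 1ℚ :+ B :* (K :- I :- con 1ℚ))
                        := (K :- I) :* (K :- con (ℕtoℚ 2)) :* B :+ (I :- con 1ℚ) :* (K :- B :- con 1ℚ)) refl K I (ℕtoℚ b))
    where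
    open +-*-Solver
    b<k : b < k
    b<k = ℕ.<-≤-trans b<a (ℕ.m∸n≤m k i)
    i<j : i < k ∸ b
    i<j = ℕ.≤-<-trans (ℕ.≤-reflexive (sym (ℕ.m∸[m∸n]≡n (ℕ.<⇒≤ i<k)))) (ℕ.∸-monoʳ-< b<a (ℕ.m∸n≤m k i))
    j≤q₀ : k ∸ b ≤ q₀
    j≤q₀ = ℕ.∸-monoʳ-≤ k i₀≤b
    edge : ℕtoℚ (edgeBound k a b) ≡ ℕtoℚ b ℚ.* (K ℚ.- I ℚ.- 1ℚ)
    edge = trans (cong ℕtoℚ (edgeBound-> b<k b<a))
                 (trans (ℕtoℚ-* b (a ∸ 1)) (cong (ℕtoℚ b ℚ.*_) (trans (ℕtoℚ-∸ 0<a) (cong (ℚ._- 1ℚ) k-i))))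

  per-clique : ∀ {b} → i₀ ≤ b → b ≤ k → left b ≡ right b
  per-clique {b} i₀≤b b≤k with ℕ.m≤n⇒m<n∨m≡n b≤k | ℕ.≤-<-connex a b
  ... | inj₂ refl | _       = per-clique-top
  ... | inj₁ b<k  | inj₁ a≤b = per-clique-upper a≤b b<k
  ... | inj₁ _    | inj₂ b<a = per-clique-lower i₀≤b b<a

  module _ {ℓ : ℕ} (G : Graph ℓ) (Φ : List (List (Fin ℓ))) (orders : All (λ T → i₀ ≤ length T × length T ≤ k) Φ) where

    E A₁ A₂ A₃ : ℕ
    E  = ∑ (edgeBound k a ∘ length) Φ
    A₁ = ∑ (weight 2 q₀ (_∸ 1) ∘ length) Φ
    A₂ = ∑ (weight 2 i (_∸ 1) ∘ length) Φ
    A₃ = ∑ (weight (suc i) q₀ (λ _ → 1) ∘ length) Φ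

    counting-identity : (i ∸ 1) * cnt G Φ k + (k ∸ 1) * (A₂ + (i ∸ 1) * A₃ + E) ≡ a * (k ∸ 2) * ∑ length Φ + (i ∸ 1) * A₁
    counting-identity = begin
      (i ∸ 1) * cnt G Φ k + (k ∸ 1) * (A₂ + (i ∸ 1) * A₃ + E)
        ≡⟨ cong (λ n → (i ∸ 1) * n + (k ∸ 1) * (A₂ + (i ∸ 1) * A₃ + E)) (cnt≡∑ G Φ k) ⟩
      (i ∸ 1) * ∑ (λ T → 𝟙 (length T ≟ k)) Φ + (k ∸ 1) * (A₂ + (i ∸ 1) * A₃ + E)
        ≡⟨ ∑-linearˡ (i ∸ 1) (k ∸ 1) _ _ _ _ Φ ⟨
      ∑ (left ∘ length) Φ
        ≡⟨ ∑-cong Φ (λ T∈Φ → per-clique (proj₁ (All.lookup orders T∈Φ)) (proj₂ (All.lookup orders T∈Φ))) ⟩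
      ∑ (right ∘ length) Φ
        ≡⟨ ∑-linearʳ (a * (k ∸ 2)) (i ∸ 1) length _ Φ ⟩
      a * (k ∸ 2) * ∑ length Φ + (i ∸ 1) * A₁ ∎
      where open ≡-Reasoning

    sumRange-by-order : ∀ p q (c : ℕ → ℕ) (g : ℕ → ℚ) → q ≤ k →
                        (∀ j → g j ℚ.* ℕtoℚ ℓ ≡ ℕtoℚ (c j * cnt G Φ (k ∸ j))) →
                        sumRange p q g ℚ.* ℕtoℚ ℓ ≡ ℕtoℚ (∑ (weight p q c ∘ length) Φ)
    sumRange-by-order p q c g q≤k gℓ =
      trans (∑-cast g (λ j → c j * cnt G Φ (k ∸ j)) (ℕtoℚ ℓ) gℓ (interval p q))
            (cong ℕtoℚ (∑-by-coorder G k (All.map proj₂ orders) c (interval p q) (interval-unique p q)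
                                     (All.tabulate λ j∈ → ℕ.≤-trans (proj₂ (∈-interval⁻ j∈)) q≤k)))

-- With q = 1/(k-1), the difference of the two sides is
-- (q·(k-1) - 1)·C - 2q·(counting identity), once the per-ℓ counts are substituted.
rational-identity :
  ∀ (Q K₁ K₂ F I₁ A NK A₁ A₂ A₃ E L γ d ε φk S₁ S₂ S₃ : ℚ) →
  K₁ ≡ I₁ ℚ.+ A → K₂ ≡ K₁ ℚ.- 1ℚ → F ≡ I₁ ℚ.* Q → Q ℚ.* K₁ ≡ 1ℚ →
  I₁ ℚ.* NK ℚ.+ K₁ ℚ.* (A₂ ℚ.+ I₁ ℚ.* A₃ ℚ.+ E) ≡ A ℚ.* K₂ ℚ.* L ℚ.+ I₁ ℚ.* A₁ →
  φk ℚ.* L ≡ NK → S₁ ℚ.* L ≡ A₁ → S₂ ℚ.* L ≡ A₂ → S₃ ℚ.* L ≡ A₃ →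
  let R = K₁ ℚ.* γ ℚ.+ F ℚ.* (φk ℚ.- S₁ ℚ.- K₁ ℚ.* γ) ℚ.+ S₂ ℚ.+ I₁ ℚ.* S₃ ℚ.- A ℚ.* (d ℚ.+ ℕtoℚ 2 ℚ.* ε) in
  A ℚ.* ((ℕtoℚ 2 ℚ.* (ℕtoℚ 1 ℚ.- Q ℚ.+ γ ℚ.- d ℚ.- ℕtoℚ 2 ℚ.* ε)) ℚ.* L) ≡ E ℚ.+ E ℚ.+ (R ℚ.* L ℚ.+ R ℚ.* L)
rational-identity Q _ _ _ I₁ A NK A₁ A₂ A₃ E L γ d ε φk S₁ S₂ S₃ refl refl refl q·k₁ counting φkℓ S₁ℓ S₂ℓ S₃ℓ = begin
  A ℚ.* ((ℕtoℚ 2 ℚ.* (ℕtoℚ 1 ℚ.- Q ℚ.+ γ ℚ.- d ℚ.- ℕtoℚ 2 ℚ.* ε)) ℚ.* L)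
    ≡⟨ solve 12 (λ Q I₁ A NK A₁ A₂ A₃ E L γ d ε →
         A :* ((con (ℕtoℚ 2) :* (con (ℕtoℚ 1) :- Q :+ γ :- d :- con (ℕtoℚ 2) :* ε)) :* L)
         := con (ℕtoℚ 2) :* E :+ con (ℕtoℚ 2) :* ((I₁ :+ A) :* γ :* L :+ I₁ :* Q :* (NK :- A₁ :- (I₁ :+ A) :* γ :* L)
                                                 :+ A₂ :+ I₁ :* A₃ :- A :* (d :+ con (ℕtoℚ 2) :* ε) :* L)
            :- con (ℕtoℚ 2) :* Q :* ((I₁ :* NK :+ (I₁ :+ A) :* (A₂ :+ I₁ :* A₃ :+ E)) :- (A :* (I₁ :+ A :- con 1ℚ) :* L :+ I₁ :* A₁))
            :+ (Q :* (I₁ :+ A) :- con 1ℚ) :* (con (ℕtoℚ 2) :* (A₂ :+ I₁ :* A₃ :+ E) :+ con (ℕtoℚ 2) :* I₁ :* γ :* L :- con (ℕtoℚ 2) :* A :* L))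
       refl Q I₁ A NK A₁ A₂ A₃ E L γ d ε ⟩
  balance NK A₁ A₂ A₃ ℚ.- ℕtoℚ 2 ℚ.* Q ℚ.* (P₁ ℚ.- P₂) ℚ.+ (Q ℚ.* (I₁ ℚ.+ A) ℚ.- 1ℚ) ℚ.* C
    ≡⟨ cong₂ (λ p z → balance NK A₁ A₂ A₃ ℚ.- ℕtoℚ 2 ℚ.* Q ℚ.* (p ℚ.- P₂) ℚ.+ (z ℚ.- 1ℚ) ℚ.* C) counting q·k₁ ⟩
  balance NK A₁ A₂ A₃ ℚ.- ℕtoℚ 2 ℚ.* Q ℚ.* (P₂ ℚ.- P₂) ℚ.+ (1ℚ ℚ.- 1ℚ) ℚ.* C
    ≡⟨ solve 4 (λ B Q P C → B :- con (ℕtoℚ 2) :* Q :* (P :- P) :+ (con 1ℚ :- con 1ℚ) :* C := B) refl (balance NK A₁ A₂ A₃) Q P₂ C ⟩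
  balance NK A₁ A₂ A₃
    ≡⟨ cong₂ (λ u₀ u₁ → balance u₀ u₁ A₂ A₃) φkℓ S₁ℓ ⟨
  balance (φk ℚ.* L) (S₁ ℚ.* L) A₂ A₃
    ≡⟨ cong₂ (λ u₂ u₃ → balance (φk ℚ.* L) (S₁ ℚ.* L) u₂ u₃) S₂ℓ S₃ℓ ⟨
  balance (φk ℚ.* L) (S₁ ℚ.* L) (S₂ ℚ.* L) (S₃ ℚ.* L)
    ≡⟨ solve 12 (λ Q I₁ A E L γ d ε φk S₁ S₂ S₃ →
         con (ℕtoℚ 2) :* E :+ con (ℕtoℚ 2) :* ((I₁ :+ A) :* γ :* L :+ I₁ :* Q :* (φk :* L :- S₁ :* L :- (I₁ :+ A) :* γ :* L)
                                                 :+ S₂ :* L :+ I₁ :* (S₃ :* L) :- A :* (d :+ con (ℕtoℚ 2) :* ε) :* L)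
         := let Rₑ = (I₁ :+ A) :* γ :+ I₁ :* Q :* (φk :- S₁ :- (I₁ :+ A) :* γ) :+ S₂ :+ I₁ :* S₃ :- A :* (d :+ con (ℕtoℚ 2) :* ε)
            in E :+ E :+ (Rₑ :* L :+ Rₑ :* L)) refl Q I₁ A E L γ d ε φk S₁ S₂ S₃ ⟩
  E ℚ.+ E ℚ.+ (R ℚ.* L ℚ.+ R ℚ.* L) ∎
  where
  open ≡-Reasoning
  open +-*-Solver
  R = (I₁ ℚ.+ A) ℚ.* γ ℚ.+ I₁ ℚ.* Q ℚ.* (φk ℚ.- S₁ ℚ.- (I₁ ℚ.+ A) ℚ.* γ) ℚ.+ S₂ ℚ.+ I₁ ℚ.* S₃ ℚ.- A ℚ.* (d ℚ.+ ℕtoℚ 2 ℚ.* ε)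
  balance : ℚ → ℚ → ℚ → ℚ → ℚ
  balance u₀ u₁ u₂ u₃ = ℕtoℚ 2 ℚ.* E ℚ.+ ℕtoℚ 2 ℚ.* ((I₁ ℚ.+ A) ℚ.* γ ℚ.* L ℚ.+ I₁ ℚ.* Q ℚ.* (u₀ ℚ.- u₁ ℚ.- (I₁ ℚ.+ A) ℚ.* γ ℚ.* L)
                                               ℚ.+ u₂ ℚ.+ I₁ ℚ.* u₃ ℚ.- A ℚ.* (d ℚ.+ ℕtoℚ 2 ℚ.* ε) ℚ.* L)
  P₁ P₂ C : ℚ
  P₁ = I₁ ℚ.* NK ℚ.+ (I₁ ℚ.+ A) ℚ.* (A₂ ℚ.+ I₁ ℚ.* A₃ ℚ.+ E)
  P₂ = A ℚ.* (I₁ ℚ.+ A ℚ.- 1ℚ) ℚ.* L ℚ.+ I₁ ℚ.* A₁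
  C = ℕtoℚ 2 ℚ.* (A₂ ℚ.+ I₁ ℚ.* A₃ ℚ.+ E) ℚ.+ ℕtoℚ 2 ℚ.* I₁ ℚ.* γ ℚ.* L ℚ.- ℕtoℚ 2 ℚ.* A ℚ.* L

at-most-one : ∀ {P : Pred A π} → Decidable P → ∀ (xs : List A) → A →
              (∀ {x y} → x ∈ xs → y ∈ xs → x ≢ y → P x → P y → ⊥) →
              ∃ λ x₀ → ∀ {x} → x ∈ xs → x ≢ x₀ → ¬ P x
at-most-one P? xs default unique with any? P? xs
... | yes some with x₀ , x₀∈ , px₀ ← find some = x₀ , λ x∈ x≢x₀ px → unique x∈ x₀∈ x≢x₀ px px₀
... | no  none = default , λ x∈ _ px → none (lose x∈ px)

module Exceptions
  (k : ℕ) (2≤k : 2 ≤ k) (γ d ε : ℚ) {ℓ : ℕ} (G : Graph ℓ)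
  (ore : ∀ (x y : Fin ℓ) → x ≢ y → adj G x y ≡ false →
           (ℕtoℚ 2 ℚ.* (ℕtoℚ 1 ℚ.- frac 1 (k ∸ 1) ℚ.+ γ ℚ.- d ℚ.- ℕtoℚ 2 ℚ.* ε)) ℚ.* ℕtoℚ ℓ
             ℚ.≤ ℕtoℚ (deg G x) ℚ.+ ℕtoℚ (deg G y))
  (Φ : List (List (Fin ℓ))) (maximal : IsMaximalCliqueCover G k Φ)
  (i₀ : ℕ) (1≤i₀ : 1 ≤ i₀) (i₀<k : i₀ < k) (empty : ∀ i → 1 ≤ i → i < i₀ → cnt G Φ i ≡ 0)
  (i : ℕ) (1≤i : 1 ≤ i) (i≤q₀ : i ≤ k ∸ i₀) where

  open Counting k i i₀ 2≤k 1≤i i≤q₀ 1≤i₀ i₀<k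

  H : ℚ
  H = (ℕtoℚ 2 ℚ.* (ℕtoℚ 1 ℚ.- frac 1 (k ∸ 1) ℚ.+ γ ℚ.- d ℚ.- ℕtoℚ 2 ℚ.* ε)) ℚ.* ℕtoℚ ℓ

  φ : ℕ → ℚ
  φ j = frac (cnt G Φ j) ℓ

  S₁ S₂ S₃ rhs : ℚ
  S₁  = sumRange 2 q₀ (λ j → ℕtoℚ (j ∸ 1) ℚ.* φ (k ∸ j))
  S₂  = sumRange 2 i (λ j → ℕtoℚ (j ∸ 1) ℚ.* φ (k ∸ j))
  S₃  = sumRange (suc i) q₀ (λ j → φ (k ∸ j))
  rhs = ℕtoℚ (k ∸ 1) ℚ.* γ ℚ.+ frac (i ∸ 1) (k ∸ 1) ℚ.* (φ k ℚ.- S₁ ℚ.- ℕtoℚ (k ∸ 1) ℚ.* γ)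
        ℚ.+ S₂ ℚ.+ ℕtoℚ (i ∸ 1) ℚ.* S₃ ℚ.- ℕtoℚ (k ∸ i) ℚ.* (d ℚ.+ ℕtoℚ 2 ℚ.* ε)

  Exception : List (Fin ℓ) → Set
  Exception K = All (λ T → ¬ OverConnected G K T) (ofOrder G Φ k) × frac (length (Λ G Φ k K)) ℓ ℚ.< rhs

  exception? : Decidable Exception
  exception? K = All.all? (λ T → ¬? (overConnected? T)) (ofOrder G Φ k) ×-dec (frac (length (Λ G Φ k K)) ℓ ℚ.<? rhs)
    where
    overConnected? : ∀ T → Dec (OverConnected G K T)
    overConnected? T = (length K * (length T ∸ 1) ≤? e G K T) ×-dec ¬? (wellConnected? G K T)

  private
    cover = proj₁ maximal

    orders : All (λ T → i₀ ≤ length T × length T ≤ k) Φ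
    orders = All.tabulate λ T∈Φ → bounds T∈Φ (All.lookup (proj₁ cover) T∈Φ)
      where
      bounds : ∀ {T} → T ∈ Φ → IsClique G T × 1 ≤ length T × length T ≤ k → i₀ ≤ length T × length T ≤ k
      bounds {T} T∈Φ (_ , 1≤T , T≤k) = ℕ.≮⇒≥ no-blocks-below-i₀ , T≤k
        where
        no-blocks-below-i₀ : ¬ length T < i₀
        no-blocks-below-i₀ T<i₀ = ℕ.<⇒≢ (∈⇒0<length (∈-filter⁺ (λ U → length U ≟ length T) T∈Φ refl))
                                       (sym (empty (length T) 1≤T T<i₀))

    E₀ : ℕ
    E₀ = E G Φ orders

    0<k-1 : 0 < k ∸ 1
    0<k-1 = ℕ.m<n⇒0<n∸m (ℕ.≤-trans (s≤s (s≤s z≤n)) 2≤k)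

    module _ (0<ℓ : 0 < ℓ) where

      per-ℓ : ∀ (c : ℕ → ℕ) j → ℕtoℚ (c j) ℚ.* φ (k ∸ j) ℚ.* ℕtoℚ ℓ ≡ ℕtoℚ (c j * cnt G Φ (k ∸ j))
      per-ℓ c j = trans (ℚ.*-assoc (ℕtoℚ (c j)) _ _)
                        (trans (cong (ℕtoℚ (c j) ℚ.*_) (frac-* (cnt G Φ (k ∸ j)) 0<ℓ)) (sym (ℕtoℚ-* (c j) _)))

      balance : ℕtoℚ a ℚ.* H ≡ ℕtoℚ E₀ ℚ.+ ℕtoℚ E₀ ℚ.+ (rhs ℚ.* ℕtoℚ ℓ ℚ.+ rhs ℚ.* ℕtoℚ ℓ)
      balance = rational-identity
        (frac 1 (k ∸ 1)) (ℕtoℚ (k ∸ 1)) (ℕtoℚ (k ∸ 2)) (frac (i ∸ 1) (k ∸ 1)) (ℕtoℚ (i ∸ 1)) (ℕtoℚ a)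
        (ℕtoℚ (cnt G Φ k)) (ℕtoℚ A₁′) (ℕtoℚ A₂′) (ℕtoℚ A₃′) (ℕtoℚ E₀) (ℕtoℚ ℓ) γ d ε (φ k) S₁ S₂ S₃
        (trans (cong ℕtoℚ k-1≡) (ℕtoℚ-+ (i ∸ 1) a))
        (trans (cong ℕtoℚ (sym (ℕ.∸-+-assoc k 1 1))) (ℕtoℚ-∸ 0<k-1))
        (frac≡ℕtoℚ* (i ∸ 1) 0<k-1)
        (frac-* 1 0<k-1)
        counting
        (frac-* (cnt G Φ k) 0<ℓ)
        (sumRange-by-order G Φ orders 2 q₀ (_∸ 1) (λ j → ℕtoℚ (j ∸ 1) ℚ.* φ (k ∸ j)) (ℕ.<⇒≤ q₀<k) (per-ℓ (_∸ 1)))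
        (sumRange-by-order G Φ orders 2 i (_∸ 1) (λ j → ℕtoℚ (j ∸ 1) ℚ.* φ (k ∸ j)) (ℕ.<⇒≤ i<k) (per-ℓ (_∸ 1)))
        (sumRange-by-order G Φ orders (suc i) q₀ (λ _ → 1) (λ j → φ (k ∸ j)) (ℕ.<⇒≤ q₀<k) λ j →
           trans (frac-* (cnt G Φ (k ∸ j)) 0<ℓ) (cong ℕtoℚ (sym (ℕ.*-identityˡ (cnt G Φ (k ∸ j))))))
        where
        A₁′ = A₁ G Φ orders
        A₂′ = A₂ G Φ orders
        A₃′ = A₃ G Φ orders
        k-1≡ : k ∸ 1 ≡ (i ∸ 1) + a
        k-1≡ = trans (cong (_∸ 1) (sym (ℕ.m+[n∸m]≡n (ℕ.<⇒≤ i<k)))) (ℕ.+-∸-comm a 1≤i)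
        counting : ℕtoℚ (i ∸ 1) ℚ.* ℕtoℚ (cnt G Φ k) ℚ.+ ℕtoℚ (k ∸ 1) ℚ.* (ℕtoℚ A₂′ ℚ.+ ℕtoℚ (i ∸ 1) ℚ.* ℕtoℚ A₃′ ℚ.+ ℕtoℚ E₀)
                   ≡ ℕtoℚ a ℚ.* ℕtoℚ (k ∸ 2) ℚ.* ℕtoℚ ℓ ℚ.+ ℕtoℚ (i ∸ 1) ℚ.* ℕtoℚ A₁′
        counting = begin
          _ ≡⟨ castˡ (i ∸ 1) (cnt G Φ k) (k ∸ 1) A₂′ A₃′ E₀ ⟨
          ℕtoℚ ((i ∸ 1) * cnt G Φ k + (k ∸ 1) * (A₂′ + (i ∸ 1) * A₃′ + E₀))
            ≡⟨ cong ℕtoℚ (counting-identity G Φ orders) ⟩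
          ℕtoℚ (a * (k ∸ 2) * ∑ length Φ + (i ∸ 1) * A₁′)
            ≡⟨ cong (λ n → ℕtoℚ (a * (k ∸ 2) * n + (i ∸ 1) * A₁′)) (order≡∑length G cover) ⟨
          ℕtoℚ (a * (k ∸ 2) * ℓ + (i ∸ 1) * A₁′)                            ≡⟨ castʳ a (k ∸ 2) ℓ (i ∸ 1) A₁′ ⟩
          _ ∎
          where open ≡-Reasoning

  no-two-exceptions : ∀ {K K′} → K ∈ ofOrder G Φ a → K′ ∈ ofOrder G Φ a → K ≢ K′ →
                      Exception K → Exception K′ → ⊥
  no-two-exceptions {K} {K′} K∈ K′∈ K≢K′ (fair , few) (fair′ , few′) = ℚ.<-irrefl refl (begin-strict
    ℕtoℚ a ℚ.* H                                        ≤⟨ degree-sum-two-blocks G maximal H ore K∈Φ K′∈Φ K≢K′ |K| |K′| a<k ⟩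
    ℕtoℚ (∑ (deg G) K + ∑ (deg G) K′)                   ≤⟨ ℕtoℚ-mono-≤ (ℕ.+-mono-≤ (budget K∈Φ |K| fair) (budget K′∈Φ |K′| fair′)) ⟩
    ℕtoℚ ((E₀ + λK) + (E₀ + λK′))                        ≡⟨ trans (ℕtoℚ-+ (E₀ + λK) _) (cong₂ ℚ._+_ (ℕtoℚ-+ E₀ λK) (ℕtoℚ-+ E₀ λK′)) ⟩
    (ℕtoℚ E₀ ℚ.+ ℕtoℚ λK) ℚ.+ (ℕtoℚ E₀ ℚ.+ ℕtoℚ λK′)   <⟨ ℚ.+-mono-< (ℚ.+-monoʳ-< (ℕtoℚ E₀) (frac<⇒ℕtoℚ< 0<ℓ few))
                                                                       (ℚ.+-monoʳ-< (ℕtoℚ E₀) (frac<⇒ℕtoℚ< 0<ℓ few′)) ⟩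
    (ℕtoℚ E₀ ℚ.+ rhs ℚ.* ℕtoℚ ℓ) ℚ.+ (ℕtoℚ E₀ ℚ.+ rhs ℚ.* ℕtoℚ ℓ)
      ≡⟨ solve 2 (λ e r → (e :+ r) :+ (e :+ r) := e :+ e :+ (r :+ r)) refl (ℕtoℚ E₀) (rhs ℚ.* ℕtoℚ ℓ) ⟩
    ℕtoℚ E₀ ℚ.+ ℕtoℚ E₀ ℚ.+ (rhs ℚ.* ℕtoℚ ℓ ℚ.+ rhs ℚ.* ℕtoℚ ℓ) ≡⟨ balance 0<ℓ ⟨
    ℕtoℚ a ℚ.* H                                        ∎)
    where
    open ℚ.≤-Reasoning
    open +-*-Solver
    K∈Φ = proj₁ (∈-filter⁻ (λ T → length T ≟ a) {xs = Φ} K∈)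
    |K| = proj₂ (∈-filter⁻ (λ T → length T ≟ a) {xs = Φ} K∈)
    K′∈Φ = proj₁ (∈-filter⁻ (λ T → length T ≟ a) {xs = Φ} K′∈)
    |K′| = proj₂ (∈-filter⁻ (λ T → length T ≟ a) {xs = Φ} K′∈)
    0<ℓ : 0 < ℓ
    0<ℓ = vertices⇒0< {xs = K} (subst (0 <_) (sym |K|) 0<a)
    λK λK′ : ℕ
    λK = length (Λ G Φ k K)
    λK′ = length (Λ G Φ k K′)
    budget : ∀ {U} → U ∈ Φ → length U ≡ a → All (λ T → ¬ OverConnected G U T) (ofOrder G Φ k) →
             ∑ (deg G) U ≤ E₀ + length (Λ G Φ k U)
    budget {U} U∈Φ |U| fair = subst (λ b → ∑ (deg G) U ≤ ∑ (λ T → edgeBound k b (length T)) Φ + length (Λ G Φ k U)) |U|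
      (degree-budget G maximal U∈Φ (subst (_< k) (sym |U|) a<k) λ T T∈ → All.lookup fair T∈)

proposition2p8 :
    (k : ℕ) → 2 ≤ k → (γ d ε : ℚ) → (ℓ : ℕ) → (G : Graph ℓ) →
    (∀ (x y : Fin ℓ) → x ≢ y → adj G x y ≡ false →
      (ℕtoℚ 2 ℚ.* (ℕtoℚ 1 ℚ.- frac 1 (k ∸ 1) ℚ.+ γ ℚ.- d ℚ.- ℕtoℚ 2 ℚ.* ε)) ℚ.* ℕtoℚ ℓ
        ℚ.≤ ℕtoℚ (deg G x) ℚ.+ ℕtoℚ (deg G y)) →
    (Φ : List (List (Fin ℓ))) → IsMaximalCliqueCover G k Φ →
    (i₀ : ℕ) → 1 ≤ i₀ → i₀ ≤ k → k ≤ cnt G Φ i₀ →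
    (∀ i → 1 ≤ i → i < i₀ → cnt G Φ i < k) →
    i₀ < k →
    (∀ i → 1 ≤ i → i < i₀ → cnt G Φ i ≡ 0) →
    (i : ℕ) → 1 ≤ i → i ≤ k ∸ i₀ →
    let φ : ℕ → ℚ
        φ j = frac (cnt G Φ j) ℓ
        s : ℚ
        s = φ k ℚ.- sumRange 2 (k ∸ i₀) (λ j → ℕtoℚ (j ∸ 1) ℚ.* φ (k ∸ j))
              ℚ.- ℕtoℚ (k ∸ 1) ℚ.* γ
        rhs : ℚ
        rhs = ℕtoℚ (k ∸ 1) ℚ.* γ
              ℚ.+ frac (i ∸ 1) (k ∸ 1) ℚ.* s
              ℚ.+ sumRange 2 i (λ j → ℕtoℚ (j ∸ 1) ℚ.* φ (k ∸ j))
              ℚ.+ ℕtoℚ (i ∸ 1) ℚ.* sumRange (ℕ.suc i) (k ∸ i₀) (λ j → φ (k ∸ j))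
              ℚ.- ℕtoℚ (k ∸ i) ℚ.* (d ℚ.+ ℕtoℚ 2 ℚ.* ε)
    in ∃ λ (K₀ : List (Fin ℓ)) →
         ∀ K → K ∈ ofOrder G Φ (k ∸ i) →
         (∀ K′ → K′ ∈ ofOrder G Φ k → ¬ OverConnected G K K′) →
         K ≢ K₀ →
         rhs ℚ.≤ frac (length (Λ G Φ k K)) ℓ
proposition2p8 k 2≤k γ d ε ℓ G ore Φ maximal i₀ 1≤i₀ _ _ _ i₀<k empty i 1≤i i≤q₀ =
  K₀ , λ K K∈ fair K≢K₀ → ℚ.≮⇒≥ λ few → unexceptional K∈ K≢K₀ (All.tabulate (fair _) , few)
  where
  open Exceptions k 2≤k γ d ε G ore Φ maximal i₀ 1≤i₀ i₀<k empty i 1≤i i≤q₀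
  K₀ = proj₁ (at-most-one exception? (ofOrder G Φ (k ∸ i)) [] no-two-exceptions)
  unexceptional = proj₂ (at-most-one exception? (ofOrder G Φ (k ∸ i)) [] no-two-exceptions)
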